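{- Let $G$ be a simple connected graph with $|E(G)|\ge4$ and let $v\in V(G)$. Let $\bar G$ be obtained from $G$ by attaching three new pendant vertices $a,b,c$ to $v$, let $\widetilde G=\bar G+\{a,b\}$, and let $\widehat G=\bar G+\{a,b\}+\{b,c\}$. Then $\mathscr{K}(\widehat G)>\mathscr{K}(\widetilde G)$.
   Context: For connected $H$ with $m\ge1$ edges and degrees $d_i$, Kemeny's constant is $\mathscr{K}(H)=\sum_j\pi_jm_{ij}$ for the simple random walk on $H$ ($\pi_j=d_j/2m$, $m_{ij}$ expected hitting time of $j$ from $i$, $m_{jj}=0$), equivalently $\frac1{4m}\sum_{i,j}d_id_jr_H(i,j)$ with $r_H$ effective resistance. $H+\{x,y\}$ denotes $H$ with the edge $\{x,y\}$ added. -}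

module Defs where

open import Data.Bool using (Bool; true; false; _∨_; _∧_; if_then_else_)
open import Data.Nat as ℕ using (ℕ; zero; suc)
open import Data.Fin using (Fin; zero; suc; toℕ)
open import Data.Fin.Properties using (_≟_)
open import Data.Integer using (+_)
open import Data.Rational using (ℚ; 0ℚ; 1ℚ; _+_; _*_; _/_)
open import Relation.Nullary.Decidable using (⌊_⌋)
open import Relation.Binary.PropositionalEquality using (_≡_; _≢_)

Graph : ℕ → Set
Graph n = Fin n → Fin n → Bool

record IsSimple {n : ℕ} (G : Graph n) : Set where
  field
    symmetric   : ∀ i j → G i j ≡ G j i
    irreflexive : ∀ i → G i i ≡ false

data Walk {n : ℕ} (G : Graph n) : Fin n → Fin n → Set where
  here : ∀ {i} → Walk G i i
  step : ∀ {i j k} → G i j ≡ true → Walk G j k → Walk G i k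

Connected : {n : ℕ} → Graph n → Set
Connected {n} G = ∀ (i j : Fin n) → Walk G i j

Σℕ : (n : ℕ) → (Fin n → ℕ) → ℕ
Σℕ zero    f = 0
Σℕ (suc n) f = f zero ℕ.+ Σℕ n (λ i → f (suc i))

Σℚ : (n : ℕ) → (Fin n → ℚ) → ℚ
Σℚ zero    f = 0ℚ
Σℚ (suc n) f = f zero + Σℚ n (λ i → f (suc i))

𝟙 : Bool → ℕ
𝟙 true  = 1
𝟙 false = 0

ℕtoℚ : ℕ → ℚ
ℕtoℚ k = (+ k) / 1

-- 1/k as a rational, with the convention 1/0 = 0 (never used at 0 below:
-- all graphs considered are connected with at least one edge)
inv : ℕ → ℚ
inv zero    = 0ℚ
inv (suc k) = (+ 1) / suc k

degree : {n : ℕ} → Graph n → Fin n → ℕ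
degree {n} G i = Σℕ n (λ j → 𝟙 (G i j))

edgeCount : {n : ℕ} → Graph n → ℕ
edgeCount {n} G = Σℕ n (λ i → Σℕ n (λ j → 𝟙 (⌊ toℕ i ℕ.<? toℕ j ⌋ ∧ G i j)))

P : {n : ℕ} → Graph n → Fin n → Fin n → ℚ
P G i k = if G i k then inv (degree G i) else 0ℚ

-- m is the matrix of expected hitting times of the simple random walk on G:
-- m j j = 0 and, for i ≠ j, m i j = 1 + Σ_k P i k * m k j (first-step equations,
-- whose unique solution for a connected graph is the hitting-time matrix).
IsHittingTimes : {n : ℕ} → Graph n → (Fin n → Fin n → ℚ) → Set
IsHittingTimes {n} G m =
  (∀ j → m j j ≡ 0ℚ) ×' (∀ i j → i ≢ j → m i j ≡ 1ℚ + Σℚ n (λ k → P G i k * m k j))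
  where
    open import Data.Product using () renaming (_×_ to _×'_)

kemeny : {n : ℕ} → Graph n → (Fin n → Fin n → ℚ) → Fin n → ℚ
kemeny {n} G m i = Σℚ n (λ j → (ℕtoℚ (degree G j) * inv (2 ℕ.* edgeCount G)) * m i j)

addEdge : {n : ℕ} → Graph n → Fin n → Fin n → Graph n
addEdge H x y p q =
  H p q ∨ (⌊ p ≟ x ⌋ ∧ ⌊ q ≟ y ⌋) ∨ (⌊ p ≟ y ⌋ ∧ ⌊ q ≟ x ⌋)

-- Ḡ on Fin (3 + n): vertices 0,1,2 are the new pendant vertices a,b,c,
-- and suc (suc (suc i)) is the old vertex i of G.
pa pb pc : {n : ℕ} → Fin (3 ℕ.+ n)
pa = zero
pb = suc zero
pc = suc (suc zero)

old : {n : ℕ} → Fin n → Fin (3 ℕ.+ n)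
old i = suc (suc (suc i))

attach3 : {n : ℕ} → Graph n → Fin n → Graph (3 ℕ.+ n)
attach3 G v (suc (suc (suc i))) (suc (suc (suc j))) = G i j
attach3 G v (suc (suc (suc i))) _ = ⌊ i ≟ v ⌋
attach3 G v _ (suc (suc (suc j))) = ⌊ j ≟ v ⌋
attach3 G v _ _ = false

Gtilde : {n : ℕ} → Graph n → Fin n → Graph (3 ℕ.+ n)
Gtilde G v = addEdge (attach3 G v) pa pb

Ghat : {n : ℕ} → Graph n → Fin n → Graph (3 ℕ.+ n)
Ghat G v = addEdge (addEdge (attach3 G v) pa pb) pb pc

module Submission where

-- Both graphs agree with Ḡ outside the gadget {a, b, c}, so everything is computed from the walk on G̃.
-- Hitting-time columns are the unique solutions of the first-step equations (maximum principle), and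
-- Σⱼ dⱼ m(i, j) is harmonic in i, hence independent of i: both Kemeny constants may be evaluated from
-- i = v.  Kac's formula d_y (1 + (P m(·, y))(y)) = 2|E| together with the first-step equations inside
-- the gadget gives the hitting times of a, b and c; for an old vertex j,
-- m̂(v, j) = (1 + κ) m̃(v, j) + κ m̃(j, v) with κ = 2/W and W = 2|E(G̃)|.  With B = Σⱼ dⱼ m̃(j, v),
--   W (W + 2) (K(Ĝ) − K(G̃)) = (2B − (W − 8)) + (2W² − 35W + 60)/6,
-- where 2B ≥ W − 8 by Kac's formula at v, and the quadratic is positive once W ≥ 16, i.e. |E(G)| ≥ 4.

module Kemeny where

  open import Agda.Builtin.FromNat using (fromNat)
  open import Algebra.Bundles using (CommutativeMonoid)
  import Algebra.Properties.CommutativeSemigroup as CommutativeSemigroupₚ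
  import Algebra.Properties.Group as Groupₚ
  open import Data.Bool using (Bool; true; false; _∨_; _∧_; if_then_else_)
  import Data.Bool.Properties as Boolₚ
  open import Data.Empty using (⊥-elim)
  open import Data.Fin using (Fin; zero; suc; toℕ)
  open import Data.Fin.Properties using (_≟_)
  import Data.Fin.Properties as Finₚ
  import Data.Integer as ℤ
  import Data.Integer.Literals as ℤLiterals
  import Data.Integer.Properties as ℤₚ
  open import Data.List using (allFin; _∷_; [])
  import Data.List.Extrema
  open import Data.List.Membership.Propositional.Properties using (∈-allFin)
  import Data.List.Relation.Unary.All as All
  open import Data.Nat as ℕ using (ℕ; zero; suc)
  import Data.Nat.Coprimality as Coprime
  import Data.Nat.Literals as ℕLiterals
  import Data.Nat.Properties as ℕₚ
  open import Data.Product using (Σ; _×_; _,_; proj₁; proj₂)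
  open import Data.Rational hiding (floor; ceiling; _≟_)
  import Data.Rational.Literals as ℚLiterals
  open import Data.Rational.Properties hiding (_≟_)
  import Data.Rational.Properties as ℚₚ
  import Data.Rational.Unnormalised as ℚᵘ
  import Data.Rational.Unnormalised.Properties as ℚᵘₚ
  open import Data.Unit using (tt)
  open import Function using (_∘_)
  open import Relation.Binary.Bundles using (DecTotalOrder)
  open import Relation.Binary.PropositionalEquality
  open import Relation.Nullary using (Dec; yes; no; ¬_)
  open import Relation.Nullary.Decidable using (⌊_⌋; dec⇒maybe)
  open import Tactic.RingSolver using (solve-∀; solve)
  open import Tactic.RingSolver.Core.AlmostCommutativeRing using (AlmostCommutativeRing; fromCommutativeRing)

  open import Defs

  instance
    ℕ-number = ℕLiterals.number
    ℤ-number = ℤLiterals.number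
    ℚ-number = ℚLiterals.number
    ⊤-instance = tt

  -- Rational arithmetic

  module ℚ+ = CommutativeSemigroupₚ (CommutativeMonoid.commutativeSemigroup +-0-commutativeMonoid)
  module ℚ* = CommutativeSemigroupₚ (CommutativeMonoid.commutativeSemigroup *-1-commutativeMonoid)
  module ℚ-Group = Groupₚ +-0-group
  module ℕ+ = CommutativeSemigroupₚ ℕₚ.+-commutativeSemigroup

  ringℚ : AlmostCommutativeRing _ _
  ringℚ = fromCommutativeRing +-*-commutativeRing (λ x → dec⇒maybe (0ℚ ℚₚ.≟ x))

  ℕtoℚ≡mkℚ : ∀ k → ℕtoℚ k ≡ mkℚ (ℤ.+ k) 0 (Coprime.sym (Coprime.1-coprimeTo k))
  ℕtoℚ≡mkℚ k = normalize-coprime (Coprime.sym (Coprime.1-coprimeTo k))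

  ℕtoℚ-+ : ∀ a b → ℕtoℚ (a ℕ.+ b) ≡ ℕtoℚ a + ℕtoℚ b
  ℕtoℚ-+ a b = toℚᵘ-injective (ℚᵘₚ.≃-trans sum≃ (ℚᵘₚ.≃-sym (toℚᵘ-homo-+ (ℕtoℚ a) (ℕtoℚ b))))
    where
    open ℤ using (+_)
    open ≡-Reasoning
    sum≃ : toℚᵘ (ℕtoℚ (a ℕ.+ b)) ℚᵘ.≃ toℚᵘ (ℕtoℚ a) ℚᵘ.+ toℚᵘ (ℕtoℚ b)
    sum≃ rewrite ℕtoℚ≡mkℚ a | ℕtoℚ≡mkℚ b | ℕtoℚ≡mkℚ (a ℕ.+ b) = ℚᵘ.*≡* (begin
      + (a ℕ.+ b) ℤ.* + 1                     ≡⟨ ℤₚ.*-identityʳ _ ⟩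
      + (a ℕ.+ b)                             ≡⟨ ℤₚ.pos-+ a b ⟩
      + a ℤ.+ + b                             ≡⟨ cong₂ ℤ._+_ (ℤₚ.*-identityʳ (+ a)) (ℤₚ.*-identityʳ (+ b)) ⟨
      + a ℤ.* + 1 ℤ.+ + b ℤ.* + 1             ≡⟨ ℤₚ.*-identityʳ _ ⟨
      (+ a ℤ.* + 1 ℤ.+ + b ℤ.* + 1) ℤ.* + 1   ∎)

  ℕtoℚ-nonNeg : ∀ k → 0ℚ ≤ ℕtoℚ k
  ℕtoℚ-nonNeg k rewrite ℕtoℚ≡mkℚ k = nonNegative⁻¹ _

  ℕtoℚ-mono-≤ : ∀ {a b} → a ℕ.≤ b → ℕtoℚ a ≤ ℕtoℚ b
  ℕtoℚ-mono-≤ {a} a≤b with ℕₚ.m≤n⇒∃[o]m+o≡n a≤b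
  ... | c , refl = begin
    ℕtoℚ a              ≡⟨ +-identityʳ (ℕtoℚ a) ⟨
    ℕtoℚ a + 0ℚ         ≤⟨ +-monoʳ-≤ (ℕtoℚ a) (ℕtoℚ-nonNeg c) ⟩
    ℕtoℚ a + ℕtoℚ c     ≡⟨ ℕtoℚ-+ a c ⟨
    ℕtoℚ (a ℕ.+ c)      ∎
    where open ≤-Reasoning

  inv-suc≡1/ : ∀ k → inv (suc k) ≡ 1/ mkℚ (ℤ.+ suc k) 0 (Coprime.sym (Coprime.1-coprimeTo (suc k)))
  inv-suc≡1/ k = normalize-coprime (Coprime.1-coprimeTo (suc k))

  ℕtoℚ*inv≡1 : ∀ {k} → k ≢ 0 → ℕtoℚ k * inv k ≡ 1ℚ
  ℕtoℚ*inv≡1 {zero}  k≢0 = ⊥-elim (k≢0 refl)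
  ℕtoℚ*inv≡1 {suc k} _ rewrite ℕtoℚ≡mkℚ (suc k) | inv-suc≡1/ k =
    *-inverseʳ (mkℚ (ℤ.+ suc k) 0 (Coprime.sym (Coprime.1-coprimeTo (suc k))))

  ℕtoℚ≢0 : ∀ {k} → k ≢ 0 → ℕtoℚ k ≢ 0ℚ
  ℕtoℚ≢0 {k} k≢0 k≡0 = 1≢0 (trans (sym (ℕtoℚ*inv≡1 k≢0)) (trans (cong (_* inv k) k≡0) (*-zeroˡ (inv k))))

  inv≢0 : ∀ {k} → k ≢ 0 → inv k ≢ 0ℚ
  inv≢0 {k} k≢0 k⁻¹≡0 = 1≢0 (trans (sym (ℕtoℚ*inv≡1 k≢0)) (trans (cong (ℕtoℚ k *_) k⁻¹≡0) (*-zeroʳ (ℕtoℚ k))))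

  *-cancelˡ-≡ : ∀ {r p q} → r ≢ 0ℚ → r * p ≡ r * q → p ≡ q
  *-cancelˡ-≡ {r} {p} {q} r≢0 rp≡rq = begin
    p                ≡⟨ *-identityˡ p ⟨
    1ℚ * p           ≡⟨ cong (_* p) (*-inverseˡ r) ⟨
    1/ r * r * p     ≡⟨ *-assoc (1/ r) r p ⟩
    1/ r * (r * p)   ≡⟨ cong (1/ r *_) rp≡rq ⟩
    1/ r * (r * q)   ≡⟨ *-assoc (1/ r) r q ⟨
    1/ r * r * q     ≡⟨ cong (_* q) (*-inverseˡ r) ⟩
    1ℚ * q           ≡⟨ *-identityˡ q ⟩
    q                ∎
    where
    open ≡-Reasoning
    instance _ = ≢-nonZero r≢0

  inv-nonNeg : ∀ k → 0ℚ ≤ inv k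
  inv-nonNeg zero    = ≤-refl
  inv-nonNeg (suc k) rewrite inv-suc≡1/ k = nonNegative⁻¹ _

  inv-pos : ∀ k → 0ℚ < inv (suc k)
  inv-pos k rewrite inv-suc≡1/ k = positive⁻¹ _

  *-nonNeg : ∀ {p q} → 0ℚ ≤ p → 0ℚ ≤ q → 0ℚ ≤ p * q
  *-nonNeg {p} {q} 0≤p 0≤q = nonNegative⁻¹ _ {{nonNeg*nonNeg⇒nonNeg p {{nonNegative 0≤p}} q {{nonNegative 0≤q}}}}

  *-pos : ∀ {p q} → 0ℚ < p → 0ℚ < q → 0ℚ < p * q
  *-pos {p} {q} 0<p 0<q = positive⁻¹ _ {{pos*pos⇒pos p {{positive 0<p}} q {{positive 0<q}}}}

  p≤q⇒0≤q-p : ∀ {p q} → p ≤ q → 0ℚ ≤ q - p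
  p≤q⇒0≤q-p {p} {q} p≤q = subst (_≤ q - p) (+-inverseʳ p) (+-monoˡ-≤ (- p) p≤q)

  0≤q-p⇒p≤q : ∀ {p q} → 0ℚ ≤ q - p → p ≤ q
  0≤q-p⇒p≤q {p} {q} 0≤q-p = begin
    p             ≡⟨ +-identityʳ p ⟨
    p + 0ℚ        ≤⟨ +-monoʳ-≤ p 0≤q-p ⟩
    p + (q - p)   ≡⟨ solve (p ∷ q ∷ []) ringℚ ⟩
    q             ∎
    where open ≤-Reasoning

  0<q-p⇒p<q : ∀ {p q} → 0ℚ < q - p → p < q
  0<q-p⇒p<q {p} {q} 0<q-p = begin-strict
    p             ≡⟨ +-identityʳ p ⟨
    p + 0ℚ        <⟨ +-monoʳ-< p 0<q-p ⟩
    p + (q - p)   ≡⟨ solve (p ∷ q ∷ []) ringℚ ⟩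
    q             ∎
    where open ≤-Reasoning

  p-q≤0⇒p≤q : ∀ {p q} → p - q ≤ 0ℚ → p ≤ q
  p-q≤0⇒p≤q {p} {q} p-q≤0 = begin
    p             ≡⟨ ℚ-Group.//-rightDividesˡ q p ⟨
    p - q + q     ≤⟨ +-monoˡ-≤ q p-q≤0 ⟩
    0ℚ + q        ≡⟨ +-identityˡ q ⟩
    q             ∎
    where open ≤-Reasoning

  [a+b]-[a+c]≡b-c : ∀ a b c → (a + b) - (a + c) ≡ b - c
  [a+b]-[a+c]≡b-c = solve-∀ ringℚ

  [v+a]-s≡v⇒a≡s : ∀ {v a s} → (v + a) - s ≡ v → a ≡ s
  [v+a]-s≡v⇒a≡s {v} {a} {s} eq = begin
    a                     ≡⟨ solve (v ∷ a ∷ s ∷ []) ringℚ ⟩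
    (v + a) - s + s - v   ≡⟨ cong (λ t → t + s - v) eq ⟩
    v + s - v             ≡⟨ solve (v ∷ s ∷ []) ringℚ ⟩
    s                     ∎
    where open ≡-Reasoning

  y+c*[a-a]≡y : ∀ y c a → y + c * (a - a) ≡ y
  y+c*[a-a]≡y y c a =
    trans (cong (λ t → y + c * t) (+-inverseʳ a)) (trans (cong (y +_) (*-zeroʳ c)) (+-identityʳ y))

  linear-combination₁ : ∀ {x y a₁ b₁} c₁ → a₁ ≡ b₁ → x ≡ y + c₁ * (a₁ - b₁) → x ≡ y
  linear-combination₁ {y = y} {a₁} c₁ refl x≡ = trans x≡ (y+c*[a-a]≡y y c₁ a₁)

  linear-combination₂ : ∀ {x y a₁ b₁ a₂ b₂} c₁ c₂ → a₁ ≡ b₁ → a₂ ≡ b₂ →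
                        x ≡ y + c₁ * (a₁ - b₁) + c₂ * (a₂ - b₂) → x ≡ y
  linear-combination₂ {a₂ = a₂} c₁ c₂ e₁ refl x≡ =
    linear-combination₁ c₁ e₁ (trans x≡ (y+c*[a-a]≡y _ c₂ a₂))

  linear-combination₃ : ∀ {x y a₁ b₁ a₂ b₂ a₃ b₃} c₁ c₂ c₃ → a₁ ≡ b₁ → a₂ ≡ b₂ → a₃ ≡ b₃ →
                        x ≡ y + c₁ * (a₁ - b₁) + c₂ * (a₂ - b₂) + c₃ * (a₃ - b₃) → x ≡ y
  linear-combination₃ {a₃ = a₃} c₁ c₂ c₃ e₁ e₂ refl x≡ =
    linear-combination₂ c₁ c₂ e₁ e₂ (trans x≡ (y+c*[a-a]≡y _ c₃ a₃))

  linear-combination₄ : ∀ {x y a₁ b₁ a₂ b₂ a₃ b₃ a₄ b₄} c₁ c₂ c₃ c₄ →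
                        a₁ ≡ b₁ → a₂ ≡ b₂ → a₃ ≡ b₃ → a₄ ≡ b₄ →
                        x ≡ y + c₁ * (a₁ - b₁) + c₂ * (a₂ - b₂) + c₃ * (a₃ - b₃) + c₄ * (a₄ - b₄) → x ≡ y
  linear-combination₄ {a₄ = a₄} c₁ c₂ c₃ c₄ e₁ e₂ e₃ refl x≡ =
    linear-combination₃ c₁ c₂ c₃ e₁ e₂ e₃ (trans x≡ (y+c*[a-a]≡y _ c₄ a₄))

  -- Finite sums

  Σℚ-cong : ∀ n {f g : Fin n → ℚ} → (∀ i → f i ≡ g i) → Σℚ n f ≡ Σℚ n g
  Σℚ-cong zero    f≡g = refl
  Σℚ-cong (suc n) f≡g = cong₂ _+_ (f≡g zero) (Σℚ-cong n (f≡g ∘ suc))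

  Σℚ-zero : ∀ n → Σℚ n (λ _ → 0ℚ) ≡ 0ℚ
  Σℚ-zero zero    = refl
  Σℚ-zero (suc n) = trans (+-identityˡ _) (Σℚ-zero n)

  Σℚ-distrib-+ : ∀ n (f g : Fin n → ℚ) → Σℚ n (λ i → f i + g i) ≡ Σℚ n f + Σℚ n g
  Σℚ-distrib-+ zero    f g = sym (+-identityˡ 0ℚ)
  Σℚ-distrib-+ (suc n) f g = trans (cong ((f zero + g zero) +_) (Σℚ-distrib-+ n (f ∘ suc) (g ∘ suc)))
                                   (ℚ+.interchange (f zero) (g zero) _ _)

  Σℚ-neg : ∀ n (f : Fin n → ℚ) → Σℚ n (λ i → - f i) ≡ - Σℚ n f
  Σℚ-neg zero    f = refl
  Σℚ-neg (suc n) f = trans (cong (- f zero +_) (Σℚ-neg n (f ∘ suc))) (sym (neg-distrib-+ (f zero) _))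

  Σℚ-distrib-sub : ∀ n (f g : Fin n → ℚ) → Σℚ n (λ i → f i - g i) ≡ Σℚ n f - Σℚ n g
  Σℚ-distrib-sub n f g = trans (Σℚ-distrib-+ n f (λ i → - g i)) (cong (Σℚ n f +_) (Σℚ-neg n g))

  *-distribˡ-Σℚ : ∀ n c (f : Fin n → ℚ) → c * Σℚ n f ≡ Σℚ n (λ i → c * f i)
  *-distribˡ-Σℚ zero    c f = *-zeroʳ c
  *-distribˡ-Σℚ (suc n) c f =
    trans (*-distribˡ-+ c (f zero) _) (cong (c * f zero +_) (*-distribˡ-Σℚ n c (f ∘ suc)))

  *-distribʳ-Σℚ : ∀ n c (f : Fin n → ℚ) → Σℚ n f * c ≡ Σℚ n (λ i → f i * c)
  *-distribʳ-Σℚ n c f = trans (*-comm _ c) (trans (*-distribˡ-Σℚ n c f) (Σℚ-cong n (λ i → *-comm c (f i))))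

  Σℚ-comm : ∀ m n (f : Fin m → Fin n → ℚ) → Σℚ m (λ i → Σℚ n (f i)) ≡ Σℚ n (λ j → Σℚ m (λ i → f i j))
  Σℚ-comm zero    n f = sym (Σℚ-zero n)
  Σℚ-comm (suc m) n f = trans (cong (Σℚ n (f zero) +_) (Σℚ-comm m n (f ∘ suc)))
                              (sym (Σℚ-distrib-+ n (f zero) (λ j → Σℚ m (λ i → f (suc i) j))))

  Σℚ-point : ∀ n (v : Fin n) (f : Fin n → ℚ) → (∀ j → j ≢ v → f j ≡ 0ℚ) → Σℚ n f ≡ f v
  Σℚ-point (suc n) zero    f f≡0 =
    trans (cong (f zero +_) (trans (Σℚ-cong n (λ j → f≡0 (suc j) λ ())) (Σℚ-zero n))) (+-identityʳ (f zero))
  Σℚ-point (suc n) (suc v) f f≡0 =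
    trans (cong (_+ Σℚ n (f ∘ suc)) (f≡0 zero λ ()))
          (trans (+-identityˡ _) (Σℚ-point n v (f ∘ suc) (λ j j≢v → f≡0 (suc j) (j≢v ∘ Finₚ.suc-injective))))

  Σℚ-mono-≤ : ∀ n {f g : Fin n → ℚ} → (∀ i → f i ≤ g i) → Σℚ n f ≤ Σℚ n g
  Σℚ-mono-≤ zero    f≤g = ≤-refl
  Σℚ-mono-≤ (suc n) f≤g = +-mono-≤ (f≤g zero) (Σℚ-mono-≤ n (f≤g ∘ suc))

  Σℚ-nonNeg : ∀ n {f : Fin n → ℚ} → (∀ i → 0ℚ ≤ f i) → 0ℚ ≤ Σℚ n f
  Σℚ-nonNeg n {f} 0≤f = subst (_≤ Σℚ n f) (Σℚ-zero n) (Σℚ-mono-≤ n 0≤f)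

  Σℚ-nonNeg-≡0 : ∀ n {f : Fin n → ℚ} → (∀ i → 0ℚ ≤ f i) → Σℚ n f ≡ 0ℚ → ∀ i → f i ≡ 0ℚ
  Σℚ-nonNeg-≡0 (suc n) {f} 0≤f Σ≡0 i = ≤-antisym (f≤0 i) (0≤f i)
    where
    f₀ = f zero
    rest = Σℚ n (f ∘ suc)
    f₀≤0 : f₀ ≤ 0ℚ
    f₀≤0 = subst₂ _≤_ (+-identityʳ f₀) Σ≡0 (+-monoʳ-≤ f₀ (Σℚ-nonNeg n (0≤f ∘ suc)))
    rest≡0 : rest ≡ 0ℚ
    rest≡0 = ≤-antisym (subst₂ _≤_ (+-identityˡ rest) Σ≡0 (+-monoˡ-≤ rest (0≤f zero))) (Σℚ-nonNeg n (0≤f ∘ suc))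
    f≤0 : ∀ i → f i ≤ 0ℚ
    f≤0 zero    = f₀≤0
    f≤0 (suc i) = ≤-reflexive (Σℚ-nonNeg-≡0 n (0≤f ∘ suc) rest≡0 i)

  Σℕ-cong : ∀ n {f g : Fin n → ℕ} → (∀ i → f i ≡ g i) → Σℕ n f ≡ Σℕ n g
  Σℕ-cong zero    f≡g = refl
  Σℕ-cong (suc n) f≡g = cong₂ ℕ._+_ (f≡g zero) (Σℕ-cong n (f≡g ∘ suc))

  Σℕ-zero : ∀ n → Σℕ n (λ _ → 0) ≡ 0
  Σℕ-zero zero    = refl
  Σℕ-zero (suc n) = Σℕ-zero n

  Σℕ-distrib-+ : ∀ n (f g : Fin n → ℕ) → Σℕ n (λ i → f i ℕ.+ g i) ≡ Σℕ n f ℕ.+ Σℕ n g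
  Σℕ-distrib-+ zero    f g = refl
  Σℕ-distrib-+ (suc n) f g = trans (cong ((f zero ℕ.+ g zero) ℕ.+_) (Σℕ-distrib-+ n (f ∘ suc) (g ∘ suc)))
                                   (ℕ+.interchange (f zero) (g zero) _ _)

  Σℕ-comm : ∀ m n (f : Fin m → Fin n → ℕ) → Σℕ m (λ i → Σℕ n (f i)) ≡ Σℕ n (λ j → Σℕ m (λ i → f i j))
  Σℕ-comm zero    n f = sym (Σℕ-zero n)
  Σℕ-comm (suc m) n f = trans (cong (Σℕ n (f zero) ℕ.+_) (Σℕ-comm m n (f ∘ suc)))
                              (sym (Σℕ-distrib-+ n (f zero) (λ j → Σℕ m (λ i → f (suc i) j))))

  Σℕ-point : ∀ n (v : Fin n) (f : Fin n → ℕ) → (∀ j → j ≢ v → f j ≡ 0) → Σℕ n f ≡ f v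
  Σℕ-point (suc n) zero    f f≡0 =
    trans (cong (f zero ℕ.+_) (trans (Σℕ-cong n (λ j → f≡0 (suc j) λ ())) (Σℕ-zero n))) (ℕₚ.+-identityʳ (f zero))
  Σℕ-point (suc n) (suc v) f f≡0 =
    trans (cong (ℕ._+ Σℕ n (f ∘ suc)) (f≡0 zero λ ()))
          (Σℕ-point n v (f ∘ suc) (λ j j≢v → f≡0 (suc j) (j≢v ∘ Finₚ.suc-injective)))

  f≤Σℕf : ∀ n (f : Fin n → ℕ) i → f i ℕ.≤ Σℕ n f
  f≤Σℕf (suc n) f zero    = ℕₚ.m≤m+n (f zero) _
  f≤Σℕf (suc n) f (suc i) = ℕₚ.≤-trans (f≤Σℕf n (f ∘ suc) i) (ℕₚ.m≤n+m _ (f zero))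

  ℕtoℚ-Σ : ∀ n (f : Fin n → ℕ) → ℕtoℚ (Σℕ n f) ≡ Σℚ n (ℕtoℚ ∘ f)
  ℕtoℚ-Σ zero    f = refl
  ℕtoℚ-Σ (suc n) f = trans (ℕtoℚ-+ (f zero) _) (cong (ℕtoℚ (f zero) +_) (ℕtoℚ-Σ n (f ∘ suc)))

  ⌊i≟i⌋ : ∀ {n} (i : Fin n) → ⌊ i ≟ i ⌋ ≡ true
  ⌊i≟i⌋ i = cong ⌊_⌋ (≡-≟-identity _≟_ refl)

  ⌊i≟j⌋≡false : ∀ {n} {i j : Fin n} → i ≢ j → ⌊ i ≟ j ⌋ ≡ false
  ⌊i≟j⌋≡false i≢j = cong ⌊_⌋ (≢-≟-identity _≟_ i≢j)

  Σℕ-indicator : ∀ n (v : Fin n) (b : Fin n → Bool) → (∀ j → b j ≡ ⌊ j ≟ v ⌋) → Σℕ n (λ j → 𝟙 (b j)) ≡ 1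
  Σℕ-indicator n v b b≡ =
    trans (Σℕ-point n v (λ j → 𝟙 (b j)) (λ j j≢v → cong 𝟙 (trans (b≡ j) (⌊i≟j⌋≡false j≢v))))
          (cong 𝟙 (trans (b≡ v) (⌊i≟i⌋ v)))

  Σℚ-indicator : ∀ n (v : Fin n) (b : Fin n → Bool) → (∀ j → b j ≡ ⌊ j ≟ v ⌋) →
                 ∀ (f : Fin n → ℚ) → Σℚ n (λ j → ℕtoℚ (𝟙 (b j)) * f j) ≡ f v
  Σℚ-indicator n v b b≡ f =
    trans (Σℚ-point n v (λ j → ℕtoℚ (𝟙 (b j)) * f j)
                    (λ j j≢v → trans (cong (λ c → ℕtoℚ (𝟙 c) * f j) (trans (b≡ j) (⌊i≟j⌋≡false j≢v))) (*-zeroˡ (f j))))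
          (trans (cong (λ c → ℕtoℚ (𝟙 c) * f v) (trans (b≡ v) (⌊i≟i⌋ v))) (*-identityˡ (f v)))

  -- Graphs

  module _ {N : ℕ} {H : Graph N} where

    walk-++ : ∀ {a b c} → Walk H a b → Walk H b c → Walk H a c
    walk-++ here       w′ = w′
    walk-++ (step e w) w′ = step e (walk-++ w w′)

    walk-mono : ∀ {H′ : Graph N} → (∀ p r → H p r ≡ true → H′ p r ≡ true) → ∀ {a b} → Walk H a b → Walk H′ a b
    walk-mono H⊆H′ here       = here
    walk-mono H⊆H′ (step e w) = step (H⊆H′ _ _ e) (walk-mono H⊆H′ w)

  module _ {N : ℕ} (H : Graph N) (x y : Fin N) where

    addEdge-⊇ : ∀ p r → H p r ≡ true → addEdge H x y p r ≡ true
    addEdge-⊇ p r Hpr rewrite Hpr = refl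

    addEdge-simple : IsSimple H → x ≢ y → IsSimple (addEdge H x y)
    addEdge-simple H-simple x≢y = record { symmetric = symmetric ; irreflexive = irreflexive }
      where
      symmetric : ∀ i j → addEdge H x y i j ≡ addEdge H x y j i
      symmetric i j rewrite IsSimple.symmetric H-simple i j
        | Boolₚ.∧-comm ⌊ i ≟ x ⌋ ⌊ j ≟ y ⌋ | Boolₚ.∧-comm ⌊ i ≟ y ⌋ ⌊ j ≟ x ⌋
        | Boolₚ.∨-comm (⌊ j ≟ y ⌋ ∧ ⌊ i ≟ x ⌋) (⌊ j ≟ x ⌋ ∧ ⌊ i ≟ y ⌋) = refl
      irreflexive : ∀ i → addEdge H x y i i ≡ false
      irreflexive i rewrite IsSimple.irreflexive H-simple i with i ≟ x | i ≟ y
      ... | yes refl | yes refl = ⊥-elim (x≢y refl)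
      ... | yes _    | no _     = refl
      ... | no _     | yes _    = refl
      ... | no _     | no _     = refl

    addEdge-connected : Connected H → Connected (addEdge H x y)
    addEdge-connected H-conn i j = walk-mono (addEdge-⊇) (H-conn i j)

  handshake : ∀ {N} (H : Graph N) → IsSimple H → 2 ℕ.* edgeCount H ≡ Σℕ N (degree H)
  handshake {N} H H-simple = sym (begin
    Σℕ N (λ i → Σℕ N (λ j → 𝟙 (H i j)))
      ≡⟨ Σℕ-cong N (λ i → trans (Σℕ-cong N (𝟙-split i)) (Σℕ-distrib-+ N _ _)) ⟩
    Σℕ N (λ i → Σℕ N (λ j → 𝟙 (i <ᵇ j ∧ H i j)) ℕ.+ Σℕ N (λ j → 𝟙 (j <ᵇ i ∧ H i j)))
      ≡⟨ Σℕ-distrib-+ N _ _ ⟩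
    edgeCount H ℕ.+ Σℕ N (λ i → Σℕ N (λ j → 𝟙 (j <ᵇ i ∧ H i j)))
      ≡⟨ cong (edgeCount H ℕ.+_) (Σℕ-comm N N _) ⟩
    edgeCount H ℕ.+ Σℕ N (λ j → Σℕ N (λ i → 𝟙 (j <ᵇ i ∧ H i j)))
      ≡⟨ cong (edgeCount H ℕ.+_)
              (Σℕ-cong N (λ j → Σℕ-cong N (λ i → cong (λ b → 𝟙 (j <ᵇ i ∧ b)) (IsSimple.symmetric H-simple i j)))) ⟩
    edgeCount H ℕ.+ edgeCount H
      ≡⟨ cong (edgeCount H ℕ.+_) (ℕₚ.+-identityʳ _) ⟨
    2 ℕ.* edgeCount H ∎)
    where
    open ≡-Reasoning
    _<ᵇ_ : Fin N → Fin N → Bool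
    i <ᵇ j = ⌊ toℕ i ℕ.<? toℕ j ⌋
    𝟙-split : ∀ i j → 𝟙 (H i j) ≡ 𝟙 (⌊ toℕ i ℕ.<? toℕ j ⌋ ∧ H i j) ℕ.+ 𝟙 (⌊ toℕ j ℕ.<? toℕ i ⌋ ∧ H i j)
    𝟙-split i j with toℕ i ℕ.<? toℕ j | toℕ j ℕ.<? toℕ i
    ... | yes i<j | yes j<i = ⊥-elim (ℕₚ.<-asym i<j j<i)
    ... | yes _   | no _    = sym (ℕₚ.+-identityʳ _)
    ... | no _    | yes _   = refl
    ... | no i≮j  | no j≮i  = cong 𝟙 (subst (λ k → H i k ≡ false) i≡j (IsSimple.irreflexive H-simple i))
      where
      i≡j : i ≡ j
      i≡j = Finₚ.toℕ-injective (ℕₚ.≤-antisym (ℕₚ.≮⇒≥ j≮i) (ℕₚ.≮⇒≥ i≮j))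

  module Extremaℚ = Data.List.Extrema (DecTotalOrder.totalOrder ≤-decTotalOrder)

  argmax : ∀ {N} (f : Fin N → ℚ) → Fin N → Σ (Fin N) λ i₀ → ∀ i → f i ≤ f i₀
  argmax {N} f i =
    Extremaℚ.argmax f i (allFin N) , λ j → All.lookup (Extremaℚ.f[xs]≤f[argmax] i (allFin N)) (∈-allFin j)

  argmin : ∀ {N} (f : Fin N → ℚ) → Fin N → Σ (Fin N) λ i₀ → ∀ i → f i₀ ≤ f i
  argmin {N} f i =
    Extremaℚ.argmin f i (allFin N) , λ j → All.lookup (Extremaℚ.f[argmin]≤f[xs] i (allFin N)) (∈-allFin j)

  -- Simple random walks

  module RandomWalk {N : ℕ} (H : Graph N) (H-symmetric : ∀ i j → H i j ≡ H j i) where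

    deg : Fin N → ℚ
    deg i = ℕtoℚ (degree H i)

    vol : ℚ
    vol = Σℚ N deg

    P∙ : (Fin N → ℚ) → Fin N → ℚ
    P∙ f i = Σℚ N (λ k → P H i k * f k)

    IsHittingColumn : (Fin N → ℚ) → Fin N → Set
    IsHittingColumn h y = h y ≡ 0ℚ × (∀ i → i ≢ y → h i ≡ 1ℚ + P∙ h i)

    hittingColumn : ∀ {m} → IsHittingTimes H m → ∀ y → IsHittingColumn (λ i → m i y) y
    hittingColumn (m-diag , m-firstStep) y = m-diag y , λ i i≢y → m-firstStep i y i≢y

    degree≢0 : ∀ {i k} → H i k ≡ true → degree H i ≢ 0
    degree≢0 {i} {k} Hik = ℕₚ.m<n⇒n≢0 (subst (λ b → 𝟙 b ℕ.≤ degree H i) Hik (f≤Σℕf N (λ j → 𝟙 (H i j)) k))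

    deg*P : ∀ i k → deg i * P H i k ≡ ℕtoℚ (𝟙 (H i k))
    deg*P i k with H i k in Hik
    ... | true  = ℕtoℚ*inv≡1 (degree≢0 Hik)
    ... | false = *-zeroʳ (deg i)

    P-nonNeg : ∀ i k → 0ℚ ≤ P H i k
    P-nonNeg i k with H i k
    ... | true  = inv-nonNeg (degree H i)
    ... | false = ≤-refl

    P∙-cong-adjacent : ∀ i {f g} → (∀ k → H i k ≡ true → f k ≡ g k) → P∙ f i ≡ P∙ g i
    P∙-cong-adjacent i {f} {g} f≡g = Σℚ-cong N term≡
      where
      term≡ : ∀ k → P H i k * f k ≡ P H i k * g k
      term≡ k with H i k in Hik
      ... | true  = cong (inv (degree H i) *_) (f≡g k Hik)
      ... | false = trans (*-zeroˡ (f k)) (sym (*-zeroˡ (g k)))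

    P∙-+ : ∀ f g i → P∙ (λ k → f k + g k) i ≡ P∙ f i + P∙ g i
    P∙-+ f g i = trans (Σℚ-cong N (λ k → *-distribˡ-+ (P H i k) (f k) (g k))) (Σℚ-distrib-+ N _ _)

    P∙-* : ∀ c f i → P∙ (λ k → c * f k) i ≡ c * P∙ f i
    P∙-* c f i = trans (Σℚ-cong N (λ k → ℚ*.x∙yz≈y∙xz (P H i k) c (f k))) (sym (*-distribˡ-Σℚ N c _))

    P∙-neg : ∀ f i → P∙ (λ k → - f k) i ≡ - P∙ f i
    P∙-neg f i = trans (Σℚ-cong N (λ k → sym (neg-distribʳ-* (P H i k) (f k)))) (Σℚ-neg N _)

    P∙-sub : ∀ f g i → P∙ (λ k → f k - g k) i ≡ P∙ f i - P∙ g i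
    P∙-sub f g i = trans (P∙-+ f (λ k → - g k) i) (cong (P∙ f i +_) (P∙-neg g i))

    deg*P∙ : ∀ f i → deg i * P∙ f i ≡ Σℚ N (λ k → ℕtoℚ (𝟙 (H i k)) * f k)
    deg*P∙ f i = trans (*-distribˡ-Σℚ N (deg i) _)
                       (Σℚ-cong N (λ k → trans (sym (*-assoc (deg i) (P H i k) (f k))) (cong (_* f k) (deg*P i k))))

    P∙≡inv[deg]*Σ : ∀ f i → P∙ f i ≡ inv (degree H i) * Σℚ N (λ k → ℕtoℚ (𝟙 (H i k)) * f k)
    P∙≡inv[deg]*Σ f i = trans (Σℚ-cong N term≡) (sym (*-distribˡ-Σℚ N (inv (degree H i)) _))
      where
      term≡ : ∀ k → P H i k * f k ≡ inv (degree H i) * (ℕtoℚ (𝟙 (H i k)) * f k)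
      term≡ k with H i k
      ... | true  = cong (inv (degree H i) *_) (sym (*-identityˡ (f k)))
      ... | false = trans (*-zeroˡ (f k))
                          (sym (trans (cong (inv (degree H i) *_) (*-zeroˡ (f k))) (*-zeroʳ (inv (degree H i)))))

    P∙-const : ∀ {i k} → H i k ≡ true → ∀ c → P∙ (λ _ → c) i ≡ c
    P∙-const {i} Hik c = *-cancelˡ-≡ (ℕtoℚ≢0 (degree≢0 Hik)) (begin
      deg i * P∙ (λ _ → c) i                   ≡⟨ deg*P∙ (λ _ → c) i ⟩
      Σℚ N (λ k → ℕtoℚ (𝟙 (H i k)) * c)        ≡⟨ *-distribʳ-Σℚ N c _ ⟨
      Σℚ N (λ k → ℕtoℚ (𝟙 (H i k))) * c        ≡⟨ cong (_* c) (ℕtoℚ-Σ N (λ k → 𝟙 (H i k))) ⟨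
      deg i * c                                ∎)
      where open ≡-Reasoning

    P∙-affine : ∀ {i k} → H i k ≡ true → ∀ a b c f g →
                P∙ (λ k → a * f k - b * g k + c) i ≡ a * P∙ f i - b * P∙ g i + c
    P∙-affine {i} Hik a b c f g = begin
      P∙ (λ k → a * f k - b * g k + c) i
        ≡⟨ P∙-+ (λ k → a * f k - b * g k) (λ _ → c) i ⟩
      P∙ (λ k → a * f k - b * g k) i + P∙ (λ _ → c) i
        ≡⟨ cong₂ _+_ (P∙-sub (λ k → a * f k) (λ k → b * g k) i) (P∙-const Hik c) ⟩
      P∙ (λ k → a * f k) i - P∙ (λ k → b * g k) i + c
        ≡⟨ cong₂ (λ s t → s - t + c) (P∙-* a f i) (P∙-* b g i) ⟩
      a * P∙ f i - b * P∙ g i + c ∎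
      where open ≡-Reasoning

    P∙-mono-≤ : ∀ {f g} → (∀ k → f k ≤ g k) → ∀ i → P∙ f i ≤ P∙ g i
    P∙-mono-≤ f≤g i = Σℚ-mono-≤ N (λ k → *-monoˡ-≤-nonNeg (P H i k) {{nonNegative (P-nonNeg i k)}} (f≤g k))

    stationary : ∀ f → Σℚ N (λ i → deg i * P∙ f i) ≡ Σℚ N (λ k → deg k * f k)
    stationary f = begin
      Σℚ N (λ i → deg i * P∙ f i)
        ≡⟨ Σℚ-cong N (deg*P∙ f) ⟩
      Σℚ N (λ i → Σℚ N (λ k → ℕtoℚ (𝟙 (H i k)) * f k))
        ≡⟨ Σℚ-comm N N _ ⟩
      Σℚ N (λ k → Σℚ N (λ i → ℕtoℚ (𝟙 (H i k)) * f k))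
        ≡⟨ Σℚ-cong N (λ k → Σℚ-cong N (λ i → cong (λ b → ℕtoℚ (𝟙 b) * f k) (H-symmetric i k))) ⟩
      Σℚ N (λ k → Σℚ N (λ i → ℕtoℚ (𝟙 (H k i)) * f k))
        ≡⟨ Σℚ-cong N (λ k → *-distribʳ-Σℚ N (f k) _) ⟨
      Σℚ N (λ k → Σℚ N (λ i → ℕtoℚ (𝟙 (H k i))) * f k)
        ≡⟨ Σℚ-cong N (λ k → cong (_* f k) (ℕtoℚ-Σ N (λ i → 𝟙 (H k i)))) ⟨
      Σℚ N (λ k → deg k * f k) ∎
      where open ≡-Reasoning

    Σdeg*[1+f] : ∀ (f : Fin N → ℚ) → Σℚ N (λ i → deg i * (1ℚ + f i)) ≡ vol + Σℚ N (λ i → deg i * f i)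
    Σdeg*[1+f] f =
      trans (Σℚ-cong N (λ i → trans (*-distribˡ-+ (deg i) 1ℚ (f i)) (cong (_+ deg i * f i) (*-identityʳ (deg i)))))
            (Σℚ-distrib-+ N deg (λ i → deg i * f i))

    kac : ∀ {h y} → IsHittingColumn h y → deg y * (1ℚ + P∙ h y) ≡ vol
    kac {h} {y} (h-y≡0 , h-firstStep) = begin
      deg y * (1ℚ + P∙ h y)                     ≡⟨ excess-at-y ⟨
      excess y                                  ≡⟨ Σℚ-point N y excess excess-off-y ⟨
      Σℚ N excess                               ≡⟨ Σℚ-distrib-sub N (λ i → deg i * (1ℚ + P∙ h i)) (λ i → deg i * h i) ⟩
      Σℚ N (λ i → deg i * (1ℚ + P∙ h i)) - S    ≡⟨ cong (_- S) (trans (Σdeg*[1+f] (P∙ h)) (cong (vol +_) (stationary h))) ⟩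
      vol + S - S                               ≡⟨ ℚ-Group.//-rightDividesʳ S vol ⟩
      vol                                       ∎
      where
      open ≡-Reasoning
      S : ℚ
      S = Σℚ N (λ i → deg i * h i)
      excess : Fin N → ℚ
      excess i = deg i * (1ℚ + P∙ h i) - deg i * h i
      excess-off-y : ∀ i → i ≢ y → excess i ≡ 0ℚ
      excess-off-y i i≢y = trans (cong (λ t → deg i * (1ℚ + P∙ h i) - deg i * t) (h-firstStep i i≢y))
                                 (+-inverseʳ (deg i * (1ℚ + P∙ h i)))
      excess-at-y : excess y ≡ deg y * (1ℚ + P∙ h y)
      excess-at-y = trans (cong (λ t → deg y * (1ℚ + P∙ h y) - deg y * t) h-y≡0)
                          (trans (cong (λ t → deg y * (1ℚ + P∙ h y) - t) (*-zeroʳ (deg y))) (+-identityʳ _))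

    P∙-nonNeg : ∀ {f} → (∀ k → 0ℚ ≤ f k) → ∀ i → 0ℚ ≤ P∙ f i
    P∙-nonNeg 0≤f i = Σℚ-nonNeg N (λ k → *-nonNeg (P-nonNeg i k) (0≤f k))

    weightedHitting : (Fin N → Fin N → ℚ) → Fin N → ℚ
    weightedHitting m i = Σℚ N (λ j → deg j * m i j)

    kemeny≡weightedHitting : ∀ m i → kemeny H m i ≡ inv (2 ℕ.* edgeCount H) * weightedHitting m i
    kemeny≡weightedHitting m i =
      trans (Σℚ-cong N (λ j → ℚ*.xy∙z≈y∙xz (deg j) c (m i j))) (sym (*-distribˡ-Σℚ N c (λ j → deg j * m i j)))
      where c = inv (2 ℕ.* edgeCount H)

    weightedHitting-harmonic : ∀ {m} → IsHittingTimes H m → ∀ i → weightedHitting m i ≡ P∙ (weightedHitting m) i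
    weightedHitting-harmonic {m} m-hitting i = sym (begin
      P∙ (weightedHitting m) i
        ≡⟨ Σℚ-cong N (λ k → *-distribˡ-Σℚ N (P H i k) (λ j → deg j * m k j)) ⟩
      Σℚ N (λ k → Σℚ N (λ j → P H i k * (deg j * m k j)))
        ≡⟨ Σℚ-comm N N (λ k j → P H i k * (deg j * m k j)) ⟩
      Σℚ N (λ j → Σℚ N (λ k → P H i k * (deg j * m k j)))
        ≡⟨ Σℚ-cong N (λ j → P∙-* (deg j) (λ k → m k j) i) ⟩
      Σℚ N (λ j → deg j * P∙ (λ k → m k j) i)
        ≡⟨ [v+a]-s≡v⇒a≡s Σexcess≡vol ⟩
      weightedHitting m i ∎)
      where
      open ≡-Reasoning
      Pm : Fin N → ℚ
      Pm j = P∙ (λ k → m k j) i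
      excess : Fin N → ℚ
      excess j = deg j * (1ℚ + Pm j) - deg j * m i j
      excess-off-i : ∀ j → j ≢ i → excess j ≡ 0ℚ
      excess-off-i j j≢i = trans (cong (λ t → deg j * (1ℚ + Pm j) - deg j * t) (proj₂ (hittingColumn m-hitting j) i (j≢i ∘ sym)))
                                 (+-inverseʳ (deg j * (1ℚ + Pm j)))
      excess-at-i : excess i ≡ vol
      excess-at-i = begin
        deg i * (1ℚ + Pm i) - deg i * m i i   ≡⟨ cong (λ t → deg i * (1ℚ + Pm i) - deg i * t) (proj₁ m-hitting i) ⟩
        deg i * (1ℚ + Pm i) - deg i * 0ℚ      ≡⟨ cong (λ t → deg i * (1ℚ + Pm i) - t) (*-zeroʳ (deg i)) ⟩
        deg i * (1ℚ + Pm i) - 0ℚ              ≡⟨ +-identityʳ _ ⟩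
        deg i * (1ℚ + Pm i)                   ≡⟨ kac (hittingColumn m-hitting i) ⟩
        vol                                   ∎
      Σexcess≡vol : vol + Σℚ N (λ j → deg j * Pm j) - weightedHitting m i ≡ vol
      Σexcess≡vol = begin
        vol + Σℚ N (λ j → deg j * Pm j) - weightedHitting m i
          ≡⟨ cong (λ t → t - weightedHitting m i) (Σdeg*[1+f] Pm) ⟨
        Σℚ N (λ j → deg j * (1ℚ + Pm j)) - weightedHitting m i
          ≡⟨ Σℚ-distrib-sub N (λ j → deg j * (1ℚ + Pm j)) (λ j → deg j * m i j) ⟨
        Σℚ N excess
          ≡⟨ Σℚ-point N i excess excess-off-i ⟩
        excess i
          ≡⟨ excess-at-i ⟩
        vol ∎

    combination : (Fin N → ℚ) → (Fin N → ℚ) → ℚ → ℚ → Fin N → ℚ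
    combination h h′ α β k = (1ℚ + α) * h k - α * h′ k + β

    combination-shift : ∀ {h h′ g w c} α β → h g ≡ c + h w → h′ g ≡ c + h′ w →
                        combination h h′ α β g ≡ combination h h′ α β w + c
    combination-shift {h} {h′} {g} {w} {c} α β hg≡ h′g≡ =
      trans (cong₂ (λ s t → (1ℚ + α) * s - α * t + β) hg≡ h′g≡) (shift-identity α β c (h w) (h′ w))
      where
      shift-identity : ∀ α β c x z → (1ℚ + α) * (c + x) - α * (c + z) + β ≡ (1ℚ + α) * x - α * z + β + c
      shift-identity = solve-∀ ringℚ

    combination-target : ∀ {h h′ j} → h j ≡ 0ℚ → ∀ α → combination h h′ α (α * h′ j) j ≡ 0ℚ
    combination-target {h} {h′} {j} hj≡0 α =
      trans (cong (λ s → (1ℚ + α) * s - α * h′ j + α * h′ j) hj≡0) (vanish α (h′ j))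
      where
      vanish : ∀ α z → (1ℚ + α) * 0ℚ - α * z + α * z ≡ 0ℚ
      vanish = solve-∀ ringℚ

    module _ (H-connected : Connected H) where

      has-neighbour : ∀ {i j} → i ≢ j → Σ (Fin N) λ k → H i k ≡ true
      has-neighbour {i} {j} i≢j with H-connected i j
      ... | here               = ⊥-elim (i≢j refl)
      ... | step {j = k} Hik _ = k , Hik

      P∙≡max⇒adjacent≡max : ∀ {f M w w′} → (∀ k → f k ≤ M) → H w w′ ≡ true → P∙ f w ≡ M → f w′ ≡ M
      P∙≡max⇒adjacent≡max {f} {M} {w} {w′} f≤M Hww′ P∙f≡M = sym (ℚ-Group.x∙y⁻¹≈ε⇒x≈y M (f w′) M-f[w′]≡0)
        where
        Σgap≡0 : P∙ (λ k → M - f k) w ≡ 0ℚ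
        Σgap≡0 = begin
          P∙ (λ k → M - f k) w      ≡⟨ P∙-sub (λ _ → M) f w ⟩
          P∙ (λ _ → M) w - P∙ f w   ≡⟨ cong₂ _-_ (P∙-const Hww′ M) P∙f≡M ⟩
          M - M                     ≡⟨ +-inverseʳ M ⟩
          0ℚ                        ∎
          where open ≡-Reasoning
        gap[w′]≡0 : inv (degree H w) * (M - f w′) ≡ 0ℚ
        gap[w′]≡0 = subst (λ b → (if b then inv (degree H w) else 0ℚ) * (M - f w′) ≡ 0ℚ) Hww′
                      (Σℚ-nonNeg-≡0 N (λ k → *-nonNeg (P-nonNeg w k) (p≤q⇒0≤q-p (f≤M k))) Σgap≡0 w′)
        M-f[w′]≡0 : M - f w′ ≡ 0ℚ
        M-f[w′]≡0 = *-cancelˡ-≡ (inv≢0 (degree≢0 Hww′)) (trans gap[w′]≡0 (sym (*-zeroʳ (inv (degree H w)))))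

      maximum-principle : ∀ {f y} → (∀ i → i ≢ y → f i ≡ P∙ f i) → ∀ i → f i ≤ f y
      maximum-principle {f} {y} f-harmonic i = subst (f i ≤_) (sym (propagate (H-connected i₀ y) refl)) (f≤f[i₀] i)
        where
        i₀ = proj₁ (argmax f y)
        f≤f[i₀] = proj₂ (argmax f y)
        propagate : ∀ {w} → Walk H w y → f w ≡ f i₀ → f y ≡ f i₀
        propagate here fw≡max = fw≡max
        propagate (step {w} Hww′ walk) fw≡max with w ≟ y
        ... | yes refl = fw≡max
        ... | no w≢y   = propagate walk (P∙≡max⇒adjacent≡max f≤f[i₀] Hww′ (trans (sym (f-harmonic w w≢y)) fw≡max))

      hittingColumn-unique : ∀ {h h′ y} → IsHittingColumn h y → IsHittingColumn h′ y → ∀ i → h i ≡ h′ i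
      hittingColumn-unique {h} {h′} {y} h-col h′-col i =
        ≤-antisym (≤-by-maximum h-col h′-col) (≤-by-maximum h′-col h-col)
        where
        ≤-by-maximum : ∀ {g g′} → IsHittingColumn g y → IsHittingColumn g′ y → g i ≤ g′ i
        ≤-by-maximum {g} {g′} (g-y≡0 , g-firstStep) (g′-y≡0 , g′-firstStep) =
          p-q≤0⇒p≤q (subst (g i - g′ i ≤_) difference-at-y (maximum-principle difference-harmonic i))
          where
          difference-harmonic : ∀ k → k ≢ y → g k - g′ k ≡ P∙ (λ k → g k - g′ k) k
          difference-harmonic k k≢y = begin
            g k - g′ k                          ≡⟨ cong₂ _-_ (g-firstStep k k≢y) (g′-firstStep k k≢y) ⟩
            (1ℚ + P∙ g k) - (1ℚ + P∙ g′ k)      ≡⟨ [a+b]-[a+c]≡b-c 1ℚ (P∙ g k) (P∙ g′ k) ⟩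
            P∙ g k - P∙ g′ k                    ≡⟨ P∙-sub g g′ k ⟨
            P∙ (λ k → g k - g′ k) k             ∎
            where open ≡-Reasoning
          difference-at-y : g y - g′ y ≡ 0ℚ
          difference-at-y = trans (cong₂ _-_ g-y≡0 g′-y≡0) (+-inverseʳ 0ℚ)

      hittingColumn-nonNeg : ∀ {h y} → IsHittingColumn h y → ∀ i → 0ℚ ≤ h i
      hittingColumn-nonNeg {h} {y} (h-y≡0 , h-firstStep) i with argmin h y
      ... | i₀ , h[i₀]≤h with i₀ ≟ y
      ...   | yes refl = subst (_≤ h i) h-y≡0 (h[i₀]≤h i)
      ...   | no i₀≢y  = ⊥-elim (no-step (H-connected i₀ y))
        where
        no-step : ¬ Walk H i₀ y
        no-step here = i₀≢y refl
        no-step (step Hi₀k _) = <-irrefl refl (begin-strict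
          h i₀                         ≡⟨ +-identityˡ (h i₀) ⟨
          0ℚ + h i₀                    <⟨ +-monoˡ-< (h i₀) (positive⁻¹ 1ℚ) ⟩
          1ℚ + h i₀                    ≡⟨ cong (1ℚ +_) (P∙-const Hi₀k (h i₀)) ⟨
          1ℚ + P∙ (λ _ → h i₀) i₀      ≤⟨ +-monoʳ-≤ 1ℚ (P∙-mono-≤ h[i₀]≤h i₀) ⟩
          1ℚ + P∙ h i₀                 ≡⟨ h-firstStep i₀ i₀≢y ⟨
          h i₀                         ∎)
          where open ≤-Reasoning

      1≤hittingColumn : ∀ {h y} → IsHittingColumn h y → ∀ i → i ≢ y → 1ℚ ≤ h i
      1≤hittingColumn {h} h-col i i≢y = begin
        1ℚ             ≡⟨ +-identityʳ 1ℚ ⟨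
        1ℚ + 0ℚ        ≤⟨ +-monoʳ-≤ 1ℚ (P∙-nonNeg (hittingColumn-nonNeg h-col) i) ⟩
        1ℚ + P∙ h i    ≡⟨ proj₂ h-col i i≢y ⟨
        h i            ∎
        where open ≤-Reasoning

      weightedHitting-constant : ∀ {m} → IsHittingTimes H m → ∀ i i′ → weightedHitting m i ≡ weightedHitting m i′
      weightedHitting-constant m-hitting i i′ =
        ≤-antisym (maximum-principle (λ k _ → weightedHitting-harmonic m-hitting k) i)
                  (maximum-principle (λ k _ → weightedHitting-harmonic m-hitting k) i′)

      combination-firstStep : ∀ {h h′ j y} → IsHittingColumn h j → IsHittingColumn h′ y → ∀ α β i → i ≢ j → i ≢ y →
                              combination h h′ α β i ≡ 1ℚ + P∙ (combination h h′ α β) i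
      combination-firstStep {h} {h′} (_ , h-firstStep) (_ , h′-firstStep) α β i i≢j i≢y = begin
        (1ℚ + α) * h i - α * h′ i + β
          ≡⟨ cong₂ (λ s t → (1ℚ + α) * s - α * t + β) (h-firstStep i i≢j) (h′-firstStep i i≢y) ⟩
        (1ℚ + α) * (1ℚ + P∙ h i) - α * (1ℚ + P∙ h′ i) + β
          ≡⟨ affine-firstStep α β (P∙ h i) (P∙ h′ i) ⟩
        1ℚ + ((1ℚ + α) * P∙ h i - α * P∙ h′ i + β)
          ≡⟨ cong (1ℚ +_) (P∙-affine (proj₂ (has-neighbour i≢j)) (1ℚ + α) α β h h′) ⟨
        1ℚ + P∙ (combination h h′ α β) i ∎
        where
        open ≡-Reasoning
        affine-firstStep : ∀ α β p q → (1ℚ + α) * (1ℚ + p) - α * (1ℚ + q) + β ≡ 1ℚ + ((1ℚ + α) * p - α * q + β)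
        affine-firstStep = solve-∀ ringℚ

      combination-defect : ∀ {h h′ j y} → IsHittingColumn h j → IsHittingColumn h′ y → y ≢ j → ∀ α β →
                           deg y * (combination h h′ α β y - (1ℚ + P∙ (combination h h′ α β) y)) ≡ α * vol
      combination-defect {h} {h′} {j} {y} (_ , h-firstStep) h′-column y≢j α β = begin
        deg y * ((1ℚ + α) * h y - α * h′ y + β - (1ℚ + P∙ (combination h h′ α β) y))
          ≡⟨ cong₂ (λ s t → deg y * ((1ℚ + α) * s - α * t + β - (1ℚ + P∙ (combination h h′ α β) y)))
                   (h-firstStep y y≢j) (proj₁ h′-column) ⟩
        deg y * ((1ℚ + α) * (1ℚ + P∙ h y) - α * 0ℚ + β - (1ℚ + P∙ (combination h h′ α β) y))
          ≡⟨ cong (λ t → deg y * ((1ℚ + α) * (1ℚ + P∙ h y) - α * 0ℚ + β - (1ℚ + t)))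
                  (P∙-affine (proj₂ (has-neighbour y≢j)) (1ℚ + α) α β h h′) ⟩
        deg y * ((1ℚ + α) * (1ℚ + P∙ h y) - α * 0ℚ + β - (1ℚ + ((1ℚ + α) * P∙ h y - α * P∙ h′ y + β)))
          ≡⟨ defect-identity (deg y) α β (P∙ h y) (P∙ h′ y) ⟩
        α * (deg y * (1ℚ + P∙ h′ y))
          ≡⟨ cong (α *_) (kac h′-column) ⟩
        α * vol ∎
        where
        open ≡-Reasoning
        defect-identity : ∀ d α β p q → d * ((1ℚ + α) * (1ℚ + p) - α * 0ℚ + β - (1ℚ + ((1ℚ + α) * p - α * q + β)))
                                        ≡ α * (d * (1ℚ + q))
        defect-identity = solve-∀ ringℚ

  -- First-step equations of the gadgets, solved

  exit-pair : ∀ {p q x} → p ≡ 1 + ½ * (q + x) → q ≡ 1 + ½ * (p + x) → p ≡ 2 + x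
  exit-pair {p} {q} {x} p≡ q≡ = linear-combination₂ (4 / 3) (2 / 3) p≡ q≡ (solve (p ∷ q ∷ x ∷ []) ringℚ)

  G̃-hitting-pair-vertex : ∀ {x p z W} → 2 * (1 + ½ * (p + x)) ≡ W → p ≡ 1 + ½ * (z + x) → z ≡ 0ℚ → x ≡ 2 / 3 * W - 2
  G̃-hitting-pair-vertex {x} {p} {z} {W} kac p≡ z≡0 =
    linear-combination₃ (2 / 3) (- (2 / 3)) (- (1 / 3)) kac p≡ z≡0 (solve (x ∷ p ∷ z ∷ W ∷ []) ringℚ)

  G̃-hitting-pendant : ∀ {x W} → 1 * (1 + x) ≡ W → x ≡ W - 1
  G̃-hitting-pendant {x} {W} kac = linear-combination₁ 1 kac (solve (x ∷ W ∷ []) ringℚ)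

  Ĝ-hitting-outer-vertex : ∀ {y p r z W} → 2 * (1 + ½ * (p + y)) ≡ W + 2 → p ≡ 1 + 1 / 3 * (z + r + y) →
                           r ≡ 1 + ½ * (p + y) → z ≡ 0ℚ → y ≡ 5 / 8 * W - 1
  Ĝ-hitting-outer-vertex {y} {p} {r} {z} {W} kac p≡ r≡ z≡0 =
    linear-combination₄ (5 / 8) (- (3 / 4)) (- (1 / 4)) (- (1 / 4)) kac p≡ r≡ z≡0
                        (solve (y ∷ p ∷ r ∷ z ∷ W ∷ []) ringℚ)

  Ĝ-hitting-middle-vertex : ∀ {y p q z W} → 3 * (1 + 1 / 3 * (p + q + y)) ≡ W + 2 → p ≡ 1 + ½ * (z + y) →
                            q ≡ 1 + ½ * (z + y) → z ≡ 0ℚ → y ≡ ½ * W - 3 / 2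
  Ĝ-hitting-middle-vertex {y} {p} {q} {z} {W} kac p≡ q≡ z≡0 =
    linear-combination₄ ½ (- ½) (- ½) (- ½) kac p≡ q≡ z≡0 (solve (y ∷ p ∷ q ∷ z ∷ W ∷ []) ringℚ)

  Ĝ-exit-outer : ∀ t → t + 9 / 4 ≡ 1 + ½ * ((t + 5 / 2) + t)
  Ĝ-exit-outer = solve-∀ ringℚ

  Ĝ-exit-middle : ∀ t → t + 5 / 2 ≡ 1 + 1 / 3 * ((t + 9 / 4) + (t + 9 / 4) + t)
  Ĝ-exit-middle = solve-∀ ringℚ

  Ĝ-firstStep-at-v : ∀ {d F PF PM S} → d ≢ 0ℚ → d * (F - (1 + PF)) ≡ 2 →
                     d * PM ≡ (F + 9 / 4) + (F + 5 / 2) + (F + 9 / 4) + S →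
                     d * PF ≡ (F + 2) + (F + 2) + (F + 1) + S → F ≡ 1 + PM
  Ĝ-firstStep-at-v {d} {F} {PF} {PM} {S} d≢0 defect rowM rowF = *-cancelˡ-≡ d≢0
    (linear-combination₃ 1 (- 1) 1 defect rowM rowF (solve (d ∷ F ∷ PF ∷ PM ∷ S ∷ []) ringℚ))

  G̃-neighbour-sum-at-v : ∀ {d P W S} → d * (1 + P) ≡ W → d * (P + 1) ≡ 8 + S → S ≡ W - 8
  G̃-neighbour-sum-at-v {d} {P} {W} {S} kac row =
    linear-combination₂ 1 (- 1) kac row (solve (d ∷ P ∷ W ∷ S ∷ []) ringℚ)

  m+1≤2Dm : ∀ {m D} → 1 ≤ m → 1 ≤ D → 1 * (m + 1) ≤ 2 * (D * m)
  m+1≤2Dm {m} {D} 1≤m 1≤D = 0≤q-p⇒p≤q (begin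
    0ℚ                            ≤⟨ +-mono-≤ (*-nonNeg (nonNegative⁻¹ 2) (*-nonNeg (p≤q⇒0≤q-p 1≤D) 0≤m))
                                              (p≤q⇒0≤q-p 1≤m) ⟩
    2 * ((D - 1) * m) + (m - 1)   ≡⟨ solve (m ∷ D ∷ []) ringℚ ⟩
    2 * (D * m) - 1 * (m + 1)     ∎)
    where
    open ≤-Reasoning
    0≤m : 0ℚ ≤ m
    0≤m = ≤-trans (nonNegative⁻¹ 1) 1≤m

  G̃-weighted-sum : ∀ {da db dc xa xb xc W A} → da ≡ 2 → db ≡ 2 → dc ≡ 1 →
                   xa ≡ 2 / 3 * W - 2 → xb ≡ 2 / 3 * W - 2 → xc ≡ W - 1 →
                   da * xa + (db * xb + (dc * xc + A)) ≡ 11 / 3 * W - 9 + A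
  G̃-weighted-sum {W = W} {A} refl refl refl refl refl refl = solve (W ∷ A ∷ []) ringℚ

  Ĝ-weighted-sum : ∀ {da db dc ya yb yc W R R′} → da ≡ 2 → db ≡ 3 → dc ≡ 2 →
                   ya ≡ 5 / 8 * W - 1 → yb ≡ ½ * W - 3 / 2 → yc ≡ 5 / 8 * W - 1 → R ≡ R′ →
                   da * ya + (db * yb + (dc * yc + R)) ≡ 4 * W - 17 / 2 + R′
  Ĝ-weighted-sum {W = W} {R′ = R′} refl refl refl refl refl refl refl = solve (W ∷ R′ ∷ []) ringℚ

  16≤W⇒quadratic-pos : ∀ {W} → 16 ≤ W → 0ℚ < 2 * W * W - 35 * W + 60
  16≤W⇒quadratic-pos {W} 16≤W = begin-strict
    0ℚ                                   <⟨ +-mono-≤-< (*-nonNeg 0≤t 0≤2t+29) (positive⁻¹ 12) ⟩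
    (W - 16) * (2 * (W - 16) + 29) + 12  ≡⟨ solve (W ∷ []) ringℚ ⟩
    2 * W * W - 35 * W + 60              ∎
    where
    open ≤-Reasoning
    0≤t : 0ℚ ≤ W - 16
    0≤t = p≤q⇒0≤q-p 16≤W
    0≤2t+29 : 0ℚ ≤ 2 * (W - 16) + 29
    0≤2t+29 = +-mono-≤ (*-nonNeg (nonNegative⁻¹ 2) 0≤t) (nonNegative⁻¹ 29)

  kemeny-gap : ∀ {W A B κ} → 16 ≤ W → W - 8 ≤ 2 * B → κ * W ≡ 2 →
               (W + 2) * (11 / 3 * W - 9 + A) < W * (4 * W - 17 / 2 + ((1 + κ) * A + κ * B))
  kemeny-gap {W} {A} {B} {κ} 16≤W W-8≤2B κW≡2 = 0<q-p⇒p<q (begin-strict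
    0ℚ                                                      <⟨ +-mono-≤-< (p≤q⇒0≤q-p W-8≤2B)
                                                                          (*-pos (positive⁻¹ (1 / 6)) (16≤W⇒quadratic-pos 16≤W)) ⟩
    (2 * B - (W - 8)) + 1 / 6 * (2 * W * W - 35 * W + 60)   ≡⟨ gap ⟨
    W * (4 * W - 17 / 2 + ((1 + κ) * A + κ * B)) - (W + 2) * (11 / 3 * W - 9 + A) ∎)
    where
    open ≤-Reasoning
    gap : W * (4 * W - 17 / 2 + ((1 + κ) * A + κ * B)) - (W + 2) * (11 / 3 * W - 9 + A)
          ≡ (2 * B - (W - 8)) + 1 / 6 * (2 * W * W - 35 * W + 60)
    gap = linear-combination₁ (A + B) κW≡2 (solve (W ∷ A ∷ B ∷ κ ∷ []) ringℚ)

  cross-multiply-< : ∀ {α β A B x y} → A * α ≡ 1ℚ → B * β ≡ 1ℚ → 0ℚ < α * β → B * x < A * y → α * x < β * y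
  cross-multiply-< {α} {β} {A} {B} {x} {y} Aα≡1 Bβ≡1 0<αβ Bx<Ay = begin-strict
    α * x                 ≡⟨ *-identityʳ (α * x) ⟨
    α * x * 1ℚ            ≡⟨ cong (α * x *_) Bβ≡1 ⟨
    α * x * (B * β)       ≡⟨ solve (α ∷ β ∷ B ∷ x ∷ []) ringℚ ⟩
    α * β * (B * x)       <⟨ *-monoʳ-<-pos (α * β) {{positive 0<αβ}} Bx<Ay ⟩
    α * β * (A * y)       ≡⟨ solve (α ∷ β ∷ A ∷ y ∷ []) ringℚ ⟩
    β * y * (A * α)       ≡⟨ cong (β * y *_) Aα≡1 ⟩
    β * y * 1ℚ            ≡⟨ *-identityʳ (β * y) ⟩
    β * y                 ∎
    where open ≤-Reasoning

  -- The graphs G̃ and Ĝ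

  module ThreePendants {n : ℕ} (G : Graph n) (v : Fin n) (G-simple : IsSimple G) (G-connected : Connected G) where

    N : ℕ
    N = 3 ℕ.+ n

    G̃ Ĝ : Graph N
    G̃ = Gtilde G v
    Ĝ = Ghat G v

    v′ : Fin N
    v′ = old v

    ΣdegG : ℕ
    ΣdegG = Σℕ n (degree G)

    attach3-simple : IsSimple (attach3 G v)
    attach3-simple = record { symmetric = symmetric ; irreflexive = irreflexive }
      where
      symmetric : ∀ i j → attach3 G v i j ≡ attach3 G v j i
      symmetric (suc (suc (suc i))) (suc (suc (suc j))) = IsSimple.symmetric G-simple i j
      symmetric (suc (suc (suc i))) zero                = refl
      symmetric (suc (suc (suc i))) (suc zero)          = refl
      symmetric (suc (suc (suc i))) (suc (suc zero))    = refl
      symmetric zero                (suc (suc (suc j))) = refl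
      symmetric (suc zero)          (suc (suc (suc j))) = refl
      symmetric (suc (suc zero))    (suc (suc (suc j))) = refl
      symmetric zero                zero                = refl
      symmetric zero                (suc zero)          = refl
      symmetric zero                (suc (suc zero))    = refl
      symmetric (suc zero)          zero                = refl
      symmetric (suc zero)          (suc zero)          = refl
      symmetric (suc zero)          (suc (suc zero))    = refl
      symmetric (suc (suc zero))    zero                = refl
      symmetric (suc (suc zero))    (suc zero)          = refl
      symmetric (suc (suc zero))    (suc (suc zero))    = refl
      irreflexive : ∀ i → attach3 G v i i ≡ false
      irreflexive (suc (suc (suc i))) = IsSimple.irreflexive G-simple i
      irreflexive zero                = refl
      irreflexive (suc zero)          = refl
      irreflexive (suc (suc zero))    = refl

    attach3-connected : Connected (attach3 G v)
    attach3-connected i j = walk-++ (to-v′ i) (from-v′ j)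
      where
      lift : ∀ {i j} → Walk G i j → Walk (attach3 G v) (old i) (old j)
      lift here       = here
      lift (step e w) = step e (lift w)
      to-v′ : ∀ p → Walk (attach3 G v) p v′
      to-v′ zero                = step (⌊i≟i⌋ v) here
      to-v′ (suc zero)          = step (⌊i≟i⌋ v) here
      to-v′ (suc (suc zero))    = step (⌊i≟i⌋ v) here
      to-v′ (suc (suc (suc i))) = lift (G-connected i v)
      from-v′ : ∀ p → Walk (attach3 G v) v′ p
      from-v′ zero                = step (⌊i≟i⌋ v) here
      from-v′ (suc zero)          = step (⌊i≟i⌋ v) here
      from-v′ (suc (suc zero))    = step (⌊i≟i⌋ v) here
      from-v′ (suc (suc (suc i))) = lift (G-connected v i)

    G̃-simple : IsSimple G̃
    G̃-simple = addEdge-simple (attach3 G v) pa pb attach3-simple (λ ())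

    Ĝ-simple : IsSimple Ĝ
    Ĝ-simple = addEdge-simple G̃ pb pc G̃-simple (λ ())

    G̃-connected : Connected G̃
    G̃-connected = addEdge-connected (attach3 G v) pa pb attach3-connected

    Ĝ-connected : Connected Ĝ
    Ĝ-connected = addEdge-connected G̃ pb pc G̃-connected

    module T = RandomWalk G̃ (IsSimple.symmetric G̃-simple)
    module H = RandomWalk Ĝ (IsSimple.symmetric Ĝ-simple)

    Ĝ-old≡G̃-old : ∀ i k → Ĝ (old i) k ≡ G̃ (old i) k
    Ĝ-old≡G̃-old i k = Boolₚ.∨-identityʳ (G̃ (old i) k)

    degree-G̃-a : degree G̃ pa ≡ 2
    degree-G̃-a = cong ℕ.suc (Σℕ-indicator n v _ (λ j → Boolₚ.∨-identityʳ _))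

    degree-G̃-b : degree G̃ pb ≡ 2
    degree-G̃-b = cong ℕ.suc (Σℕ-indicator n v _ (λ j → Boolₚ.∨-identityʳ _))

    degree-G̃-c : degree G̃ pc ≡ 1
    degree-G̃-c = Σℕ-indicator n v _ (λ j → Boolₚ.∨-identityʳ _)

    degree-Ĝ-a : degree Ĝ pa ≡ 2
    degree-Ĝ-a = cong ℕ.suc (Σℕ-indicator n v _ (λ j → trans (Boolₚ.∨-identityʳ _) (Boolₚ.∨-identityʳ _)))

    degree-Ĝ-b : degree Ĝ pb ≡ 3
    degree-Ĝ-b =
      cong (ℕ.suc ∘ ℕ.suc) (Σℕ-indicator n v _ (λ j → trans (Boolₚ.∨-identityʳ _) (Boolₚ.∨-identityʳ _)))

    degree-Ĝ-c : degree Ĝ pc ≡ 2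
    degree-Ĝ-c = cong ℕ.suc (Σℕ-indicator n v _ (λ j → trans (Boolₚ.∨-identityʳ _) (Boolₚ.∨-identityʳ _)))

    degree-Ĝ-old : ∀ i → degree Ĝ (old i) ≡ degree G̃ (old i)
    degree-Ĝ-old i = Σℕ-cong N (λ k → cong 𝟙 (Ĝ-old≡G̃-old i k))

    Σdegree-G̃-old : Σℕ n (λ i → degree G̃ (old i)) ≡ 3 ℕ.+ ΣdegG
    Σdegree-G̃-old = begin
      Σℕ n (λ i → degree G̃ (old i))
        ≡⟨ Σℕ-cong n (λ i → cong₂ (λ b d → 𝟙 b ℕ.+ (𝟙 b ℕ.+ (𝟙 b ℕ.+ d)))
                                (Boolₚ.∨-identityʳ ⌊ i ≟ v ⌋) (Σℕ-cong n (λ j → cong 𝟙 (Boolₚ.∨-identityʳ (G i j))))) ⟩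
      Σℕ n (λ i → 𝟙 (x i) ℕ.+ (𝟙 (x i) ℕ.+ (𝟙 (x i) ℕ.+ degree G i)))
        ≡⟨ indicator-+ (λ i → 𝟙 (x i) ℕ.+ (𝟙 (x i) ℕ.+ degree G i)) ⟩
      1 ℕ.+ Σℕ n (λ i → 𝟙 (x i) ℕ.+ (𝟙 (x i) ℕ.+ degree G i))
        ≡⟨ cong ℕ.suc (indicator-+ (λ i → 𝟙 (x i) ℕ.+ degree G i)) ⟩
      2 ℕ.+ Σℕ n (λ i → 𝟙 (x i) ℕ.+ degree G i)
        ≡⟨ cong (ℕ.suc ∘ ℕ.suc) (indicator-+ (degree G)) ⟩
      3 ℕ.+ ΣdegG ∎
      where
      open ≡-Reasoning
      x : Fin n → Bool
      x i = ⌊ i ≟ v ⌋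
      indicator-+ : ∀ f → Σℕ n (λ i → 𝟙 (x i) ℕ.+ f i) ≡ 1 ℕ.+ Σℕ n f
      indicator-+ f = trans (Σℕ-distrib-+ n (𝟙 ∘ x) f) (cong (ℕ._+ Σℕ n f) (Σℕ-indicator n v x (λ _ → refl)))

    Σdegree-G̃ : Σℕ N (degree G̃) ≡ 8 ℕ.+ ΣdegG
    Σdegree-G̃ = begin
      degree G̃ pa ℕ.+ (degree G̃ pb ℕ.+ (degree G̃ pc ℕ.+ Σℕ n (λ i → degree G̃ (old i))))
        ≡⟨ cong₂ (λ a rest → a ℕ.+ rest) degree-G̃-a
                 (cong₂ ℕ._+_ degree-G̃-b (cong₂ ℕ._+_ degree-G̃-c Σdegree-G̃-old)) ⟩
      8 ℕ.+ ΣdegG ∎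
      where open ≡-Reasoning

    Σdegree-Ĝ : Σℕ N (degree Ĝ) ≡ 2 ℕ.+ Σℕ N (degree G̃)
    Σdegree-Ĝ = begin
      degree Ĝ pa ℕ.+ (degree Ĝ pb ℕ.+ (degree Ĝ pc ℕ.+ Σℕ n (λ i → degree Ĝ (old i))))
        ≡⟨ cong₂ ℕ._+_ degree-Ĝ-a (cong₂ ℕ._+_ degree-Ĝ-b (cong₂ ℕ._+_ degree-Ĝ-c
                 (trans (Σℕ-cong n degree-Ĝ-old) Σdegree-G̃-old))) ⟩
      10 ℕ.+ ΣdegG
        ≡⟨ cong (2 ℕ.+_) Σdegree-G̃ ⟨
      2 ℕ.+ Σℕ N (degree G̃) ∎
      where open ≡-Reasoning

    private
      weights-010 : ∀ a b c d → 0ℚ * a + (1ℚ * b + (0ℚ * c + d)) ≡ b + d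
      weights-010 = solve-∀ ringℚ
      weights-100 : ∀ a b c d → 1ℚ * a + (0ℚ * b + (0ℚ * c + d)) ≡ a + d
      weights-100 = solve-∀ ringℚ
      weights-000 : ∀ a b c d → 0ℚ * a + (0ℚ * b + (0ℚ * c + d)) ≡ d
      weights-000 = solve-∀ ringℚ
      weights-101 : ∀ a b c d → 1ℚ * a + (0ℚ * b + (1ℚ * c + d)) ≡ a + c + d
      weights-101 = solve-∀ ringℚ
      weights-111 : ∀ a b c d → 1ℚ * a + (1ℚ * b + (1ℚ * c + d)) ≡ a + b + c + d
      weights-111 = solve-∀ ringℚ

    gadget-row : (K : Graph N) (g : Fin N) → (∀ j → K g (old j) ≡ ⌊ j ≟ v ⌋) → ∀ f →
                 Σℚ N (λ k → ℕtoℚ (𝟙 (K g k)) * f k)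
                 ≡ ℕtoℚ (𝟙 (K g pa)) * f pa + (ℕtoℚ (𝟙 (K g pb)) * f pb + (ℕtoℚ (𝟙 (K g pc)) * f pc + f v′))
    gadget-row K g K≡ f =
      cong (λ t → ℕtoℚ (𝟙 (K g pa)) * f pa + (ℕtoℚ (𝟙 (K g pb)) * f pb + (ℕtoℚ (𝟙 (K g pc)) * f pc + t)))
           (Σℚ-indicator n v (λ j → K g (old j)) K≡ (f ∘ old))

    G̃-row-a : ∀ f → T.P∙ f pa ≡ ½ * (f pb + f v′)
    G̃-row-a f = trans (T.P∙≡inv[deg]*Σ f pa)
      (cong₂ (λ d s → inv d * s) degree-G̃-a
             (trans (gadget-row G̃ pa (λ j → Boolₚ.∨-identityʳ _) f) (weights-010 (f pa) (f pb) (f pc) (f v′))))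

    G̃-row-b : ∀ f → T.P∙ f pb ≡ ½ * (f pa + f v′)
    G̃-row-b f = trans (T.P∙≡inv[deg]*Σ f pb)
      (cong₂ (λ d s → inv d * s) degree-G̃-b
             (trans (gadget-row G̃ pb (λ j → Boolₚ.∨-identityʳ _) f) (weights-100 (f pa) (f pb) (f pc) (f v′))))

    G̃-row-c : ∀ f → T.P∙ f pc ≡ f v′
    G̃-row-c f = trans (T.P∙≡inv[deg]*Σ f pc)
      (trans (cong₂ (λ d s → inv d * s) degree-G̃-c
                    (trans (gadget-row G̃ pc (λ j → Boolₚ.∨-identityʳ _) f) (weights-000 (f pa) (f pb) (f pc) (f v′))))
             (*-identityˡ (f v′)))

    Ĝ-row-a : ∀ f → H.P∙ f pa ≡ ½ * (f pb + f v′)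
    Ĝ-row-a f = trans (H.P∙≡inv[deg]*Σ f pa)
      (cong₂ (λ d s → inv d * s) degree-Ĝ-a
             (trans (gadget-row Ĝ pa (λ j → trans (Boolₚ.∨-identityʳ _) (Boolₚ.∨-identityʳ _)) f)
                    (weights-010 (f pa) (f pb) (f pc) (f v′))))

    Ĝ-row-b : ∀ f → H.P∙ f pb ≡ 1 / 3 * (f pa + f pc + f v′)
    Ĝ-row-b f = trans (H.P∙≡inv[deg]*Σ f pb)
      (cong₂ (λ d s → inv d * s) degree-Ĝ-b
             (trans (gadget-row Ĝ pb (λ j → trans (Boolₚ.∨-identityʳ _) (Boolₚ.∨-identityʳ _)) f)
                    (weights-101 (f pa) (f pb) (f pc) (f v′))))

    Ĝ-row-c : ∀ f → H.P∙ f pc ≡ ½ * (f pb + f v′)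
    Ĝ-row-c f = trans (H.P∙≡inv[deg]*Σ f pc)
      (cong₂ (λ d s → inv d * s) degree-Ĝ-c
             (trans (gadget-row Ĝ pc (λ j → trans (Boolₚ.∨-identityʳ _) (Boolₚ.∨-identityʳ _)) f)
                    (weights-010 (f pa) (f pb) (f pc) (f v′))))

    Ĝ-row-old : ∀ i f → H.P∙ f (old i) ≡ T.P∙ f (old i)
    Ĝ-row-old i f =
      Σℚ-cong N (λ k → cong₂ (λ b d → (if b then inv d else 0ℚ) * f k) (Ĝ-old≡G̃-old i k) (degree-Ĝ-old i))

    oldNeighbourSum : (Fin N → ℚ) → ℚ
    oldNeighbourSum f = Σℚ n (λ j → ℕtoℚ (𝟙 (G v j)) * f (old j))

    G̃-row-v′ : ∀ f → T.deg v′ * T.P∙ f v′ ≡ f pa + f pb + f pc + oldNeighbourSum f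
    G̃-row-v′ f = begin
      T.deg v′ * T.P∙ f v′
        ≡⟨ T.deg*P∙ f v′ ⟩
      ℕtoℚ (𝟙 v~v′) * f pa + (ℕtoℚ (𝟙 v~v′) * f pb + (ℕtoℚ (𝟙 v~v′) * f pc
        + Σℚ n (λ j → ℕtoℚ (𝟙 (G v j ∨ false)) * f (old j))))
        ≡⟨ cong₂ (λ b s → ℕtoℚ (𝟙 b) * f pa + (ℕtoℚ (𝟙 b) * f pb + (ℕtoℚ (𝟙 b) * f pc + s)))
                 (cong (_∨ false) (⌊i≟i⌋ v))
                 (Σℚ-cong n (λ j → cong (λ b → ℕtoℚ (𝟙 b) * f (old j)) (Boolₚ.∨-identityʳ (G v j)))) ⟩
      1ℚ * f pa + (1ℚ * f pb + (1ℚ * f pc + oldNeighbourSum f))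
        ≡⟨ weights-111 (f pa) (f pb) (f pc) (oldNeighbourSum f) ⟩
      f pa + f pb + f pc + oldNeighbourSum f ∎
      where
      open ≡-Reasoning
      v~v′ : Bool
      v~v′ = ⌊ v ≟ v ⌋ ∨ false

    W : ℚ
    W = T.vol

    W≡Σdegree : W ≡ ℕtoℚ (Σℕ N (degree G̃))
    W≡Σdegree = sym (ℕtoℚ-Σ N (degree G̃))

    vol-Ĝ : H.vol ≡ W + 2
    vol-Ĝ = begin
      H.vol                              ≡⟨ ℕtoℚ-Σ N (degree Ĝ) ⟨
      ℕtoℚ (Σℕ N (degree Ĝ))             ≡⟨ cong ℕtoℚ Σdegree-Ĝ ⟩
      ℕtoℚ (2 ℕ.+ Σℕ N (degree G̃))       ≡⟨ ℕtoℚ-+ 2 (Σℕ N (degree G̃)) ⟩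
      2 + ℕtoℚ (Σℕ N (degree G̃))         ≡⟨ +-comm 2 (ℕtoℚ (Σℕ N (degree G̃))) ⟩
      ℕtoℚ (Σℕ N (degree G̃)) + 2         ≡⟨ cong (_+ 2) W≡Σdegree ⟨
      W + 2                              ∎
      where open ≡-Reasoning

    W≡ℕtoℚ[8+ΣdegG] : W ≡ ℕtoℚ (8 ℕ.+ ΣdegG)
    W≡ℕtoℚ[8+ΣdegG] = trans W≡Σdegree (cong ℕtoℚ Σdegree-G̃)

    W*inv≡1 : W * inv (8 ℕ.+ ΣdegG) ≡ 1ℚ
    W*inv≡1 = trans (cong (_* inv (8 ℕ.+ ΣdegG)) W≡ℕtoℚ[8+ΣdegG]) (ℕtoℚ*inv≡1 {8 ℕ.+ ΣdegG} (λ ()))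

    [W+2]*inv≡1 : (W + 2) * inv (10 ℕ.+ ΣdegG) ≡ 1ℚ
    [W+2]*inv≡1 = trans (cong (_* inv (10 ℕ.+ ΣdegG)) W+2≡) (ℕtoℚ*inv≡1 {10 ℕ.+ ΣdegG} (λ ()))
      where
      W+2≡ : W + 2 ≡ ℕtoℚ (10 ℕ.+ ΣdegG)
      W+2≡ = trans (cong (_+ 2) W≡ℕtoℚ[8+ΣdegG])
                   (trans (+-comm (ℕtoℚ (8 ℕ.+ ΣdegG)) 2) (sym (ℕtoℚ-+ 2 (8 ℕ.+ ΣdegG))))

    16≤W : 4 ℕ.≤ edgeCount G → 16 ≤ W
    16≤W 4≤|E| = subst (16 ≤_) (sym W≡ℕtoℚ[8+ΣdegG])
                       (ℕtoℚ-mono-≤ (ℕₚ.+-monoʳ-≤ 8 (subst (8 ℕ.≤_) (handshake G G-simple) (ℕₚ.*-monoʳ-≤ 2 4≤|E|))))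

    v′-adjacent-a : G̃ v′ pa ≡ true
    v′-adjacent-a = cong (_∨ false) (⌊i≟i⌋ v)

    module G̃-hitting {mt : Fin N → Fin N → ℚ} (mt-hitting : IsHittingTimes G̃ mt) where

      hittingTo : Fin N → Fin N → ℚ
      hittingTo y k = mt k y

      firstStep : ∀ {i y} → i ≢ y → mt i y ≡ 1 + T.P∙ (hittingTo y) i
      firstStep {i} {y} i≢y = proj₂ mt-hitting i y i≢y

      column : ∀ y → T.IsHittingColumn (hittingTo y) y
      column = T.hittingColumn mt-hitting

      kac : ∀ y {d} → degree G̃ y ≡ d → ℕtoℚ d * (1 + T.P∙ (hittingTo y) y) ≡ W
      kac y refl = T.kac (column y)

      exit-a : ∀ y → y ≢ pa → y ≢ pb → mt pa y ≡ 2 + mt v′ y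
      exit-a y y≢a y≢b = exit-pair
        (trans (firstStep (y≢a ∘ sym)) (cong (1 +_) (G̃-row-a (hittingTo y))))
        (trans (firstStep (y≢b ∘ sym)) (cong (1 +_) (G̃-row-b (hittingTo y))))

      exit-b : ∀ y → y ≢ pa → y ≢ pb → mt pb y ≡ 2 + mt v′ y
      exit-b y y≢a y≢b = exit-pair
        (trans (firstStep (y≢b ∘ sym)) (cong (1 +_) (G̃-row-b (hittingTo y))))
        (trans (firstStep (y≢a ∘ sym)) (cong (1 +_) (G̃-row-a (hittingTo y))))

      exit-c : ∀ y → y ≢ pc → mt pc y ≡ 1 + mt v′ y
      exit-c y y≢c = trans (firstStep (y≢c ∘ sym)) (cong (1 +_) (G̃-row-c (hittingTo y)))

      hit-a : mt v′ pa ≡ 2 / 3 * W - 2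
      hit-a = G̃-hitting-pair-vertex
        (trans (cong (λ t → 2 * (1 + t)) (sym (G̃-row-a (hittingTo pa)))) (kac pa degree-G̃-a))
        (trans (firstStep {pb} {pa} (λ ())) (cong (1 +_) (G̃-row-b (hittingTo pa))))
        (proj₁ mt-hitting pa)

      hit-b : mt v′ pb ≡ 2 / 3 * W - 2
      hit-b = G̃-hitting-pair-vertex
        (trans (cong (λ t → 2 * (1 + t)) (sym (G̃-row-b (hittingTo pb)))) (kac pb degree-G̃-b))
        (trans (firstStep {pa} {pb} (λ ())) (cong (1 +_) (G̃-row-a (hittingTo pb))))
        (proj₁ mt-hitting pb)

      hit-c : mt v′ pc ≡ W - 1
      hit-c = G̃-hitting-pendant
        (trans (cong (λ t → 1 * (1 + t)) (sym (G̃-row-c (hittingTo pc)))) (kac pc degree-G̃-c))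

      exit-a-to-v′ : mt pa v′ ≡ 2
      exit-a-to-v′ = trans (exit-a v′ (λ ()) (λ ())) (cong (2 +_) (proj₁ mt-hitting v′))

      exit-b-to-v′ : mt pb v′ ≡ 2
      exit-b-to-v′ = trans (exit-b v′ (λ ()) (λ ())) (cong (2 +_) (proj₁ mt-hitting v′))

      exit-c-to-v′ : mt pc v′ ≡ 1
      exit-c-to-v′ = trans (exit-c v′ (λ ())) (cong (1 +_) (proj₁ mt-hitting v′))

      oldNeighbourSum-v′ : oldNeighbourSum (λ k → mt k v′ + 1) ≡ W - 8
      oldNeighbourSum-v′ = G̃-neighbour-sum-at-v {T.deg v′} {T.P∙ h v′} (kac v′ refl) (begin
        T.deg v′ * (T.P∙ h v′ + 1)                 ≡⟨ cong (T.deg v′ *_) P∙[h+1] ⟨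
        T.deg v′ * T.P∙ (λ k → h k + 1) v′         ≡⟨ G̃-row-v′ (λ k → h k + 1) ⟩
        (h pa + 1) + (h pb + 1) + (h pc + 1) + S   ≡⟨ cong₂ (λ s t → (s + 1) + (t + 1) + (h pc + 1) + S)
                                                            exit-a-to-v′ exit-b-to-v′ ⟩
        (2 + 1) + (2 + 1) + (h pc + 1) + S         ≡⟨ cong (λ t → (2 + 1) + (2 + 1) + (t + 1) + S) exit-c-to-v′ ⟩
        8 + S                                      ∎)
        where
        open ≡-Reasoning
        h = hittingTo v′
        S = oldNeighbourSum (λ k → h k + 1)
        P∙[h+1] : T.P∙ (λ k → h k + 1) v′ ≡ T.P∙ h v′ + 1
        P∙[h+1] = trans (T.P∙-+ h (λ _ → 1) v′) (cong (T.P∙ h v′ +_) (T.P∙-const {v′} {pa} v′-adjacent-a 1))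

      B : ℚ
      B = Σℚ n (λ j → T.deg (old j) * mt (old j) v′)

      W-8≤2B : W - 8 ≤ 2 * B
      W-8≤2B = begin
        W - 8                                                 ≡⟨ oldNeighbourSum-v′ ⟨
        Σℚ n (λ j → ℕtoℚ (𝟙 (G v j)) * (mt (old j) v′ + 1))   ≤⟨ Σℚ-mono-≤ n term≤ ⟩
        Σℚ n (λ j → 2 * (T.deg (old j) * mt (old j) v′))      ≡⟨ *-distribˡ-Σℚ n 2 (λ j → T.deg (old j) * mt (old j) v′) ⟨
        2 * B                                                 ∎
        where
        open ≤-Reasoning
        term≤ : ∀ j → ℕtoℚ (𝟙 (G v j)) * (mt (old j) v′ + 1) ≤ 2 * (T.deg (old j) * mt (old j) v′)
        term≤ j with G v j in Gvj
        ... | false = subst (_≤ 2 * (T.deg (old j) * mt (old j) v′)) (sym (*-zeroˡ (mt (old j) v′ + 1)))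
                        (*-nonNeg (nonNegative⁻¹ 2) (*-nonNeg (ℕtoℚ-nonNeg (degree G̃ (old j)))
                                                              (T.hittingColumn-nonNeg G̃-connected (column v′) (old j))))
        ... | true  = m+1≤2Dm (T.1≤hittingColumn G̃-connected (column v′) (old j) old-j≢v′)
                              (ℕtoℚ-mono-≤ (ℕₚ.n≢0⇒n>0 (T.degree≢0 {old j} {v′} old-j~v′)))
          where
          old-j≢v′ : old j ≢ v′
          old-j≢v′ refl with () ← trans (sym Gvj) (IsSimple.irreflexive G-simple v)
          old-j~v′ : G̃ (old j) v′ ≡ true
          old-j~v′ = cong (_∨ false) (trans (IsSimple.symmetric G-simple j v) Gvj)

    module Ĝ-hitting {mh : Fin N → Fin N → ℚ} (mh-hitting : IsHittingTimes Ĝ mh) where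

      hittingTo : Fin N → Fin N → ℚ
      hittingTo y k = mh k y

      firstStep : ∀ {i y} → i ≢ y → mh i y ≡ 1 + H.P∙ (hittingTo y) i
      firstStep {i} {y} i≢y = proj₂ mh-hitting i y i≢y

      column : ∀ y → H.IsHittingColumn (hittingTo y) y
      column = H.hittingColumn mh-hitting

      kac : ∀ y {d} → degree Ĝ y ≡ d → ℕtoℚ d * (1 + H.P∙ (hittingTo y) y) ≡ W + 2
      kac y refl = trans (H.kac (column y)) vol-Ĝ

      hit-a : mh v′ pa ≡ 5 / 8 * W - 1
      hit-a = Ĝ-hitting-outer-vertex {W = W}
        (trans (cong (λ t → 2 * (1 + t)) (sym (Ĝ-row-a (hittingTo pa)))) (kac pa degree-Ĝ-a))
        (trans (firstStep {pb} {pa} (λ ())) (cong (1 +_) (Ĝ-row-b (hittingTo pa))))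
        (trans (firstStep {pc} {pa} (λ ())) (cong (1 +_) (Ĝ-row-c (hittingTo pa))))
        (proj₁ mh-hitting pa)

      hit-b : mh v′ pb ≡ ½ * W - 3 / 2
      hit-b = Ĝ-hitting-middle-vertex {W = W}
        (trans (cong (λ t → 3 * (1 + t)) (sym (Ĝ-row-b (hittingTo pb)))) (kac pb degree-Ĝ-b))
        (trans (firstStep {pa} {pb} (λ ())) (cong (1 +_) (Ĝ-row-a (hittingTo pb))))
        (trans (firstStep {pc} {pb} (λ ())) (cong (1 +_) (Ĝ-row-c (hittingTo pb))))
        (proj₁ mh-hitting pb)

      hit-c : mh v′ pc ≡ 5 / 8 * W - 1
      hit-c = Ĝ-hitting-outer-vertex {W = W}
        (trans (cong (λ t → 2 * (1 + t)) (sym (Ĝ-row-c (hittingTo pc)))) (kac pc degree-Ĝ-c))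
        (trans (firstStep {pb} {pc} (λ ()))
               (cong (1 +_) (trans (Ĝ-row-b (hittingTo pc))
                                   (cong (λ t → 1 / 3 * (t + mh v′ pc)) (+-comm (mh pa pc) (mh pc pc))))))
        (trans (firstStep {pa} {pc} (λ ())) (cong (1 +_) (Ĝ-row-a (hittingTo pc))))
        (proj₁ mh-hitting pc)

    module Transfer {mt mh : Fin N → Fin N → ℚ} (mt-hitting : IsHittingTimes G̃ mt) (mh-hitting : IsHittingTimes Ĝ mh) where

      module t = G̃-hitting mt-hitting
      module h = Ĝ-hitting mh-hitting

      κ : ℚ
      κ = 2 * inv (8 ℕ.+ ΣdegG)

      κ*W≡2 : κ * W ≡ 2
      κ*W≡2 = trans (*-assoc 2 (inv (8 ℕ.+ ΣdegG)) W)
                    (trans (cong (2 *_) (trans (*-comm (inv (8 ℕ.+ ΣdegG)) W) W*inv≡1)) (*-identityʳ 2))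

      -- Off the gadget the walks on G̃ and Ĝ agree.  Summed over its three entry points, the gadget of Ĝ
      -- takes 2 more steps to exit than that of G̃ (9/4 + 5/2 + 9/4 against 2 + 2 + 1), so each visit to v
      -- costs 2/d_v extra steps on average; a walk from k visits v (d_v/W)(m̃ k j + m̃ j v − m̃ k v) times
      -- before hitting j.  Hence the guess m̂ k j = m̃ k j + κ (m̃ k j + m̃ j v − m̃ k v) with κ = 2/W.
      F : Fin n → Fin N → ℚ
      F j = T.combination (t.hittingTo (old j)) (t.hittingTo v′) κ (κ * mt (old j) v′)

      F-shift : ∀ j {g c} → mt g (old j) ≡ c + mt v′ (old j) → mt g v′ ≡ c + mt v′ v′ → F j g ≡ F j v′ + c
      F-shift j {g} {c} = T.combination-shift {t.hittingTo (old j)} {t.hittingTo v′} {g} {v′} {c} κ (κ * mt (old j) v′)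

      F-gadget-a : ∀ j → F j pa ≡ F j v′ + 2
      F-gadget-a j = F-shift j (t.exit-a (old j) (λ ()) (λ ())) (t.exit-a v′ (λ ()) (λ ()))

      F-gadget-b : ∀ j → F j pb ≡ F j v′ + 2
      F-gadget-b j = F-shift j (t.exit-b (old j) (λ ()) (λ ())) (t.exit-b v′ (λ ()) (λ ()))

      F-gadget-c : ∀ j → F j pc ≡ F j v′ + 1
      F-gadget-c j = F-shift j (t.exit-c (old j) (λ ())) (t.exit-c v′ (λ ()))

      -- 9/4 and 5/2 are the expected exit times from the gadget of Ĝ, starting at a or c and at b.
      M : Fin n → Fin N → ℚ
      M j zero                = F j v′ + 9 / 4
      M j (suc zero)          = F j v′ + 5 / 2
      M j (suc (suc zero))    = F j v′ + 9 / 4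
      M j (suc (suc (suc i))) = F j (old i)

      M-firstStep-v′ : ∀ j → v ≢ j → M j v′ ≡ 1 + H.P∙ (M j) v′
      M-firstStep-v′ j v≢j =
        trans (Ĝ-firstStep-at-v {T.deg v′} {F j v′} {T.P∙ (F j) v′} {T.P∙ (M j) v′} {oldNeighbourSum (F j)}
                                (ℕtoℚ≢0 (T.degree≢0 {v′} {pa} v′-adjacent-a)) defect rowM rowF)
              (cong (1 +_) (sym (Ĝ-row-old v (M j))))
        where
        v′≢old-j : v′ ≢ old j
        v′≢old-j refl = v≢j refl
        defect : T.deg v′ * (F j v′ - (1 + T.P∙ (F j) v′)) ≡ 2
        defect = trans (T.combination-defect G̃-connected (t.column (old j)) (t.column v′) v′≢old-j κ _) κ*W≡2
        rowM : T.deg v′ * T.P∙ (M j) v′ ≡ (F j v′ + 9 / 4) + (F j v′ + 5 / 2) + (F j v′ + 9 / 4) + oldNeighbourSum (F j)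
        rowM = G̃-row-v′ (M j)
        rowF : T.deg v′ * T.P∙ (F j) v′ ≡ (F j v′ + 2) + (F j v′ + 2) + (F j v′ + 1) + oldNeighbourSum (F j)
        rowF = trans (G̃-row-v′ (F j))
                 (trans (cong₂ (λ s t → s + t + F j pc + oldNeighbourSum (F j)) (F-gadget-a j) (F-gadget-b j))
                        (cong (λ t → (F j v′ + 2) + (F j v′ + 2) + t + oldNeighbourSum (F j)) (F-gadget-c j)))

      M-firstStep-off-v′ : ∀ j i → i ≢ j → i ≢ v → M j (old i) ≡ 1 + H.P∙ (M j) (old i)
      M-firstStep-off-v′ j i i≢j i≢v = begin
        F j (old i)                  ≡⟨ T.combination-firstStep G̃-connected (t.column (old j)) (t.column v′)
                                          κ (κ * mt (old j) v′) (old i) (i≢j ∘ old-injective) (i≢v ∘ old-injective) ⟩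
        1 + T.P∙ (F j) (old i)       ≡⟨ cong (1 +_) (T.P∙-cong-adjacent (old i) F≡M-near-old-i) ⟩
        1 + T.P∙ (M j) (old i)       ≡⟨ cong (1 +_) (Ĝ-row-old i (M j)) ⟨
        1 + H.P∙ (M j) (old i)       ∎
        where
        open ≡-Reasoning
        old-injective : ∀ {k l} → old {n} k ≡ old l → k ≡ l
        old-injective refl = refl
        not-adjacent : G̃ (old i) pa ≢ true
        not-adjacent i~a with () ← trans (sym i~a) (cong (_∨ false) (⌊i≟j⌋≡false i≢v))
        F≡M-near-old-i : ∀ k → G̃ (old i) k ≡ true → F j k ≡ M j k
        F≡M-near-old-i zero                i~k = ⊥-elim (not-adjacent i~k)
        F≡M-near-old-i (suc zero)          i~k = ⊥-elim (not-adjacent i~k)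
        F≡M-near-old-i (suc (suc zero))    i~k = ⊥-elim (not-adjacent i~k)
        F≡M-near-old-i (suc (suc (suc k))) _   = refl

      M-firstStep-old : ∀ j i → i ≢ j → M j (old i) ≡ 1 + H.P∙ (M j) (old i)
      M-firstStep-old j i i≢j = by-cases (i ≟ v)
        where
        -- a helper rather than `with`, which would also abstract the tests i ≟ v inside the unfolded goal
        by-cases : Dec (i ≡ v) → M j (old i) ≡ 1 + H.P∙ (M j) (old i)
        by-cases (yes i≡v) = subst (λ k → M j (old k) ≡ 1 + H.P∙ (M j) (old k)) (sym i≡v)
                                   (M-firstStep-v′ j (λ v≡j → i≢j (trans i≡v v≡j)))
        by-cases (no i≢v)  = M-firstStep-off-v′ j i i≢j i≢v

      M-column : ∀ j → H.IsHittingColumn (M j) (old j)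
      M-column j =
        T.combination-target {t.hittingTo (old j)} {t.hittingTo v′} {old j} (proj₁ mt-hitting (old j)) κ , firstStep
        where
        firstStep : ∀ i → i ≢ old j → M j i ≡ 1 + H.P∙ (M j) i
        firstStep zero                _ = trans (Ĝ-exit-outer (F j v′)) (cong (1 +_) (sym (Ĝ-row-a (M j))))
        firstStep (suc zero)          _ = trans (Ĝ-exit-middle (F j v′)) (cong (1 +_) (sym (Ĝ-row-b (M j))))
        firstStep (suc (suc zero))    _ = trans (Ĝ-exit-outer (F j v′)) (cong (1 +_) (sym (Ĝ-row-c (M j))))
        firstStep (suc (suc (suc i))) i≢j = M-firstStep-old j i (λ i≡j → i≢j (cong old i≡j))

      hit-old : ∀ j → mh v′ (old j) ≡ (1 + κ) * mt v′ (old j) + κ * mt (old j) v′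
      hit-old j = begin
        mh v′ (old j)
          ≡⟨ H.hittingColumn-unique Ĝ-connected (h.column (old j)) (M-column j) v′ ⟩
        (1 + κ) * mt v′ (old j) - κ * mt v′ v′ + κ * mt (old j) v′
          ≡⟨ cong (λ t → (1 + κ) * mt v′ (old j) - κ * t + κ * mt (old j) v′) (proj₁ mt-hitting v′) ⟩
        (1 + κ) * mt v′ (old j) - κ * 0ℚ + κ * mt (old j) v′  ≡⟨ drop-zero (1 + κ) κ (mt v′ (old j)) (mt (old j) v′) ⟩
        (1 + κ) * mt v′ (old j) + κ * mt (old j) v′           ∎
        where
        open ≡-Reasoning
        drop-zero : ∀ a b x y → a * x - b * 0ℚ + b * y ≡ a * x + b * y
        drop-zero = solve-∀ ringℚ

      A : ℚ
      A = Σℚ n (λ j → T.deg (old j) * mt v′ (old j))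

      K̃ K̂ : ℚ
      K̃ = inv (8 ℕ.+ ΣdegG) * (11 / 3 * W - 9 + A)
      K̂ = inv (10 ℕ.+ ΣdegG) * (4 * W - 17 / 2 + ((1 + κ) * A + κ * t.B))

      kemeny-G̃ : ∀ i → kemeny G̃ mt i ≡ K̃
      kemeny-G̃ i = begin
        kemeny G̃ mt i
          ≡⟨ T.kemeny≡weightedHitting mt i ⟩
        inv (2 ℕ.* edgeCount G̃) * T.weightedHitting mt i
          ≡⟨ cong₂ (λ e w → inv e * w) (trans (handshake G̃ G̃-simple) Σdegree-G̃)
                   (T.weightedHitting-constant G̃-connected mt-hitting i v′) ⟩
        inv (8 ℕ.+ ΣdegG) * T.weightedHitting mt v′
          ≡⟨ cong (inv (8 ℕ.+ ΣdegG) *_)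
                  (G̃-weighted-sum {T.deg pa} {T.deg pb} {T.deg pc} {mt v′ pa} {mt v′ pb} {mt v′ pc} {W} {A}
                                  (cong ℕtoℚ degree-G̃-a) (cong ℕtoℚ degree-G̃-b) (cong ℕtoℚ degree-G̃-c)
                                  t.hit-a t.hit-b t.hit-c) ⟩
        K̃ ∎
        where open ≡-Reasoning

      Ĝ-weighted-old : Σℚ n (λ j → H.deg (old j) * mh v′ (old j)) ≡ (1 + κ) * A + κ * t.B
      Ĝ-weighted-old = begin
        Σℚ n (λ j → H.deg (old j) * mh v′ (old j))
          ≡⟨ Σℚ-cong n (λ j → cong₂ _*_ (cong ℕtoℚ (degree-Ĝ-old j)) (hit-old j)) ⟩
        Σℚ n (λ j → T.deg (old j) * ((1 + κ) * x j + κ * y j))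
          ≡⟨ Σℚ-cong n (λ j → distribute (T.deg (old j)) (1 + κ) κ (x j) (y j)) ⟩
        Σℚ n (λ j → (1 + κ) * (T.deg (old j) * x j) + κ * (T.deg (old j) * y j))
          ≡⟨ Σℚ-distrib-+ n (λ j → (1 + κ) * (T.deg (old j) * x j)) (λ j → κ * (T.deg (old j) * y j)) ⟩
        Σℚ n (λ j → (1 + κ) * (T.deg (old j) * x j)) + Σℚ n (λ j → κ * (T.deg (old j) * y j))
          ≡⟨ cong₂ _+_ (*-distribˡ-Σℚ n (1 + κ) (λ j → T.deg (old j) * x j)) (*-distribˡ-Σℚ n κ (λ j → T.deg (old j) * y j)) ⟨
        (1 + κ) * A + κ * t.B ∎
        where
        open ≡-Reasoning
        x y : Fin n → ℚ
        x j = mt v′ (old j)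
        y j = mt (old j) v′
        distribute : ∀ D c k x y → D * (c * x + k * y) ≡ c * (D * x) + k * (D * y)
        distribute = solve-∀ ringℚ

      kemeny-Ĝ : ∀ i → kemeny Ĝ mh i ≡ K̂
      kemeny-Ĝ i = begin
        kemeny Ĝ mh i
          ≡⟨ H.kemeny≡weightedHitting mh i ⟩
        inv (2 ℕ.* edgeCount Ĝ) * H.weightedHitting mh i
          ≡⟨ cong₂ (λ e w → inv e * w) (trans (handshake Ĝ Ĝ-simple) (trans Σdegree-Ĝ (cong (2 ℕ.+_) Σdegree-G̃)))
                   (H.weightedHitting-constant Ĝ-connected mh-hitting i v′) ⟩
        inv (10 ℕ.+ ΣdegG) * H.weightedHitting mh v′
          ≡⟨ cong (inv (10 ℕ.+ ΣdegG) *_)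
                  (Ĝ-weighted-sum {H.deg pa} {H.deg pb} {H.deg pc} {mh v′ pa} {mh v′ pb} {mh v′ pc} {W}
                                  (cong ℕtoℚ degree-Ĝ-a) (cong ℕtoℚ degree-Ĝ-b) (cong ℕtoℚ degree-Ĝ-c)
                                  h.hit-a h.hit-b h.hit-c Ĝ-weighted-old) ⟩
        K̂ ∎
        where open ≡-Reasoning

      K̃<K̂ : 4 ℕ.≤ edgeCount G → K̃ < K̂
      K̃<K̂ 4≤|E| =
        cross-multiply-< {inv (8 ℕ.+ ΣdegG)} {inv (10 ℕ.+ ΣdegG)} {W} {W + 2}
                         W*inv≡1 [W+2]*inv≡1 (*-pos (inv-pos (7 ℕ.+ ΣdegG)) (inv-pos (9 ℕ.+ ΣdegG)))
                         (kemeny-gap {W} {A} {t.B} {κ} (16≤W 4≤|E|) t.W-8≤2B κ*W≡2)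

open import Defs
open import Data.Nat using (ℕ; _≤_; _+_)
open import Data.Fin using (Fin)
open import Data.Rational using (ℚ; _<_)
open import Data.Rational.Properties using (module ≤-Reasoning)
open Kemeny using (module ThreePendants)

theorem4p12 : (n : ℕ) (G : Graph n) → IsSimple G → Connected G → 4 ≤ edgeCount G →
    (v : Fin n) (mt mh : Fin (3 + n) → Fin (3 + n) → ℚ) →
    IsHittingTimes (Gtilde G v) mt → IsHittingTimes (Ghat G v) mh →
    (i : Fin (3 + n)) → kemeny (Gtilde G v) mt i < kemeny (Ghat G v) mh i
theorem4p12 n G G-simple G-connected 4≤|E| v mt mh mt-hitting mh-hitting i = begin-strict
  kemeny (Gtilde G v) mt i   ≡⟨ kemeny-G̃ i ⟩
  K̃                          <⟨ K̃<K̂ 4≤|E| ⟩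
  K̂                          ≡⟨ kemeny-Ĝ i ⟨
  kemeny (Ghat G v) mh i     ∎
  where
  open ThreePendants G v G-simple G-connected
  open Transfer mt-hitting mh-hitting
  open ≤-Reasoning
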